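{- Let $L_n$ be the number of linear intervals in $\mathbb{F}_n^\infty$. Then $$\sum_{n\ge0}L_nx^n=\frac{1-3x+3x^2+2x^3-2x^4}{(1-2x)^2},$$ with $L_0=L_1=1$, $L_2=3$, and $L_n=(3n+1)\cdot2^{n-3}$ for $n\ge3$.
   Context: A Dyck path of semilength $n\ge 0$ is a lattice path from $(0,0)$ to $(2n,0)$ with steps $U=(1,1)$ and $D=(1,-1)$ that never goes below the $x$-axis; it is identified with its word over $\{U,D\}$. A path avoids a pattern $\alpha$ if $\alpha$ does not occur as a factor (block of consecutive steps). $\mathcal{F}_n^\infty$ is the set of Dyck paths of semilength $n$ avoiding $DUU$, ordered by the Stanley order: $P\le Q$ iff $P$ lies weakly below $Q$ when both are drawn in the plane; $\mathbb{F}_n^\infty=(\mathcal{F}_n^\infty,\le)$. An interval is $[P,Q]=\{R:P\le R\le Q\}$ for $P\le Q$ (including $P=Q$); it is linear if any two of its elements are comparable. -}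

module Defs where

open import Data.Nat as ℕ using (ℕ; zero; suc)
open import Data.Integer as ℤ using (ℤ; +_; -[1+_])
import Data.Integer.Properties as ℤP
open import Data.List using (List; []; _∷_; length; filter; map; concatMap; cartesianProduct; scanl; last)
open import Data.List.Relation.Unary.All using (All; all?)
open import Data.List.Relation.Binary.Pointwise using (Pointwise)
import Data.List.Relation.Binary.Pointwise as PW
open import Data.List.Relation.Binary.Infix.Heterogeneous using (Infix)
open import Data.List.Relation.Binary.Infix.Heterogeneous.Properties using (infix?)
open import Data.Product using (_×_; _,_)
open import Data.Sum using (_⊎_)
open import Data.Maybe using (Maybe; just; nothing)
open import Relation.Binary.PropositionalEquality using (_≡_; refl)
open import Relation.Nullary using (Dec; yes; no; ¬_)
open import Relation.Nullary.Decidable using (_×-dec_; _⊎-dec_; _→-dec_; ¬?)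

data Step : Set where
  U D : Step

_≟S_ : (a b : Step) → Dec (a ≡ b)
U ≟S U = yes refl
U ≟S D = no λ ()
D ≟S U = no λ ()
D ≟S D = yes refl

Word : Set
Word = List Step

step : Step → ℤ
step U = + 1
step D = -[1+ 0 ]

heights : Word → List ℤ
heights = scanl (λ h s → h ℤ.+ step s) (+ 0)

endHeight : Word → ℤ
endHeight [] = + 0
endHeight (s ∷ w) = step s ℤ.+ endHeight w

IsDyck : ℕ → Word → Set
IsDyck n w = (length w ≡ 2 ℕ.* n) × All (ℤ._≤_ (+ 0)) (heights w) × (endHeight w ≡ + 0)

OccursIn : Word → Word → Set
OccursIn α w = Infix _≡_ α w

DUU : Word
DUU = D ∷ U ∷ U ∷ []

IsF : ℕ → Word → Set
IsF n w = IsDyck n w × ¬ OccursIn DUU w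

isF? : (n : ℕ) (w : Word) → Dec (IsF n w)
isF? n w = ((length w ℕ.≟ 2 ℕ.* n)
           ×-dec (all? (λ h → + 0 ℤ.≤? h) (heights w)
           ×-dec (endHeight w ℤ.≟ + 0)))
           ×-dec ¬? (infix? _≟S_ DUU w)

words : ℕ → List Word
words zero = [] ∷ []
words (suc m) = concatMap (λ w → (U ∷ w) ∷ (D ∷ w) ∷ []) (words m)

F : ℕ → List Word
F n = filter (isF? n) (words (2 ℕ.* n))

_≤St_ : Word → Word → Set
P ≤St Q = Pointwise ℤ._≤_ (heights P) (heights Q)

_≤St?_ : (P Q : Word) → Dec (P ≤St Q)
P ≤St? Q = PW.decidable ℤ._≤?_ (heights P) (heights Q)

InInterval : Word → Word → Word → Set
InInterval P Q R = P ≤St R × R ≤St Q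

inInterval? : (P Q R : Word) → Dec (InInterval P Q R)
inInterval? P Q R = (P ≤St? R) ×-dec (R ≤St? Q)

Linear : ℕ → Word → Word → Set
Linear n P Q = All (λ R → All (λ S → InInterval P Q R → InInterval P Q S → (R ≤St S) ⊎ (S ≤St R)) (F n)) (F n)

linear? : (n : ℕ) (P Q : Word) → Dec (Linear n P Q)
linear? n P Q = all? (λ R → all? (λ S → inInterval? P Q R →-dec (inInterval? P Q S →-dec ((R ≤St? S) ⊎-dec (S ≤St? R)))) (F n)) (F n)

IsLinearInterval : ℕ → Word × Word → Set
IsLinearInterval n (P , Q) = P ≤St Q × Linear n P Q

isLinearInterval? : (n : ℕ) (PQ : Word × Word) → Dec (IsLinearInterval n PQ)
isLinearInterval? n (P , Q) = (P ≤St? Q) ×-dec linear? n P Q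

L : ℕ → ℕ
L n = length (filter (isLinearInterval? n) (cartesianProduct (F n) (F n)))

Series : Set
Series = ℕ → ℤ

sumTo : ℕ → (ℕ → ℤ) → ℤ
sumTo zero f = f 0
sumTo (suc n) f = sumTo n f ℤ.+ f (suc n)

_⊛_ : Series → Series → Series
(f ⊛ g) n = sumTo n (λ k → f k ℤ.* g (n ℕ.∸ k))

poly : List ℤ → Series
poly [] _ = + 0
poly (c ∷ cs) zero = c
poly (c ∷ cs) (suc n) = poly cs n

-- (1 - 2x)² = 1 - 4x + 4x²
denominator : Series
denominator = poly (+ 1 ∷ ℤ.- (+ 4) ∷ + 4 ∷ [])

numerator : Series
numerator = poly (+ 1 ∷ ℤ.- (+ 3) ∷ + 3 ∷ + 2 ∷ ℤ.- (+ 2) ∷ [])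

genL : Series
genL n = + L n

module Submission where

-- After its first down-step, a DUU-avoiding Dyck path is a sequence of the tokens D and UD.
-- Reading the tokens backwards as letters (D ↦ U, UD ↦ D) gives a bijection `encode` from all
-- words of length m onto 𝓕ₘ₊₁, and `encode` turns the Stanley order into the pointwise order ≼
-- of words as walks from height 0 with free endpoint.  In that order [x, y] is a chain iff
-- x = y or, after their common prefix, x and y continue as D u and U v with (u, v) of one of a
-- few rigid shapes (forkᵇ).  Counting such pairs by their first letters gives
-- T(m + 1) = 2 T(m) + 3 · 2ᵐ⁻¹ for the number T(m) = Lₘ₊₁ of linear intervals, whence
-- Lₙ = (3n + 1) 2ⁿ⁻³ for n ≥ 3; this sequence satisfies the recurrence of (1 - 2x)² from
-- degree 5 on, which gives the generating function.

open import Defs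
open import Data.Bool using (Bool; true; false; T; if_then_else_)
open import Data.Empty using (⊥; ⊥-elim)
open import Data.Integer as ℤ using (ℤ; +_; -[1+_])
import Data.Integer.Properties as ℤ
open import Data.Integer.Tactic.RingSolver using (solve-∀)
open import Data.List
  using (List; []; _∷_; _++_; length; replicate; reverse; null; scanl; take; drop; map; concatMap; filter;
         cartesianProduct; cartesianProductWith)
import Data.List.Properties as List
open import Data.List.Membership.Propositional using (_∈_; find)
open import Data.List.Membership.Propositional.Properties
  using (∈-concatMap⁺; ∈-concatMap⁻; ∈-filter⁺; ∈-filter⁻; ∈-map⁺; ∈-map⁻)
open import Data.List.Membership.Propositional.Properties.WithK using (unique∧set⇒bag)
open import Data.List.Relation.Binary.BagAndSetEquality using (∼bag⇒↭)
open import Data.List.Relation.Binary.Infix.Heterogeneous using (here; there)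
open import Data.List.Relation.Binary.Permutation.Propositional using (_↭_)
import Data.List.Relation.Binary.Permutation.Propositional.Properties as ↭
open import Data.List.Relation.Binary.Pointwise using (Pointwise; []; _∷_)
open import Data.List.Relation.Binary.Prefix.Heterogeneous using ([]; _∷_)
open import Data.List.Relation.Unary.All as All using (All; []; _∷_)
open import Data.List.Relation.Unary.AllPairs using ([]; _∷_)
open import Data.List.Relation.Unary.Any as Any using (here; there)
open import Data.List.Relation.Unary.Unique.Propositional using (Unique)
import Data.List.Relation.Unary.Unique.Propositional.Properties as Unique
open import Data.Nat as ℕ using (ℕ; zero; suc; _+_; _*_; _^_; _∸_; _≤_; z≤n; s≤s)
open import Data.Nat.ListAction using (sum)
import Data.Nat.ListAction.Properties as Sum
import Data.Nat.Properties as ℕ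
open import Algebra.Properties.CommutativeSemigroup ℕ.+-commutativeSemigroup using (interchange)
import Data.Nat.Tactic.RingSolver as ℕ-Solver
open import Data.Product using (∃-syntax; _×_; _,_; proj₁; proj₂)
open import Data.Sum using (_⊎_; inj₁; inj₂; [_,_]′)
open import Data.Unit using (⊤; tt)
open import Function using (_∘_; id)
open import Function.Bundles using (mk⇔)
open import Relation.Binary.PropositionalEquality
open import Relation.Nullary using (¬_; Dec; yes; no; does)
open import Relation.Nullary.Decidable using (T?; does-⇔)

-- Paths compared with slack

infix 4 _≼[_]_ _≼_

-- P ≼[ c ] Q : the path P stays weakly below the path Q drawn 2c units higher.  It is defined
-- by recursion, so that the words of an interval with a given first letter form, definitionally,
-- an interval with adjusted slacks.
_≼[_]_ : Word → ℕ → Word → Set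
[]      ≼[ c ]     []      = ⊤
(U ∷ P) ≼[ c ]     (U ∷ Q) = P ≼[ c ] Q
(D ∷ P) ≼[ c ]     (D ∷ Q) = P ≼[ c ] Q
(D ∷ P) ≼[ c ]     (U ∷ Q) = P ≼[ suc c ] Q
(U ∷ P) ≼[ zero ]  (D ∷ Q) = ⊥
(U ∷ P) ≼[ suc c ] (D ∷ Q) = P ≼[ c ] Q
[]      ≼[ c ]     (_ ∷ _) = ⊥
(_ ∷ _) ≼[ c ]     []      = ⊥

_≼_ : Word → Word → Set
P ≼ Q = P ≼[ 0 ] Q

U^_ : ℕ → Word
U^ k = replicate k U

downs : Word → ℕ
downs []      = 0
downs (U ∷ w) = downs w
downs (D ∷ w) = suc (downs w)

≼-refl : ∀ {c} P → P ≼[ c ] P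
≼-refl []      = tt
≼-refl (U ∷ P) = ≼-refl P
≼-refl (D ∷ P) = ≼-refl P

≼-length : ∀ {c} P Q → P ≼[ c ] Q → length P ≡ length Q
≼-length []      []      _ = refl
≼-length (U ∷ P) (U ∷ Q) p = cong suc (≼-length P Q p)
≼-length (D ∷ P) (D ∷ Q) p = cong suc (≼-length P Q p)
≼-length (D ∷ P) (U ∷ Q) p = cong suc (≼-length P Q p)
≼-length {suc c} (U ∷ P) (D ∷ Q) p = cong suc (≼-length P Q p)

≼-antisym : ∀ P Q → P ≼ Q → Q ≼ P → P ≡ Q
≼-antisym []      []      _ _ = refl
≼-antisym (U ∷ P) (U ∷ Q) p q = cong (U ∷_) (≼-antisym P Q p q)
≼-antisym (D ∷ P) (D ∷ Q) p q = cong (D ∷_) (≼-antisym P Q p q)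

≼-trans : ∀ {a b} P Q R → P ≼[ a ] Q → Q ≼[ b ] R → P ≼[ a + b ] R
≼-trans []      []      []      _ _ = tt
≼-trans (U ∷ P) (U ∷ Q) (U ∷ R) p q = ≼-trans P Q R p q
≼-trans (D ∷ P) (D ∷ Q) (D ∷ R) p q = ≼-trans P Q R p q
≼-trans (D ∷ P) (U ∷ Q) (U ∷ R) p q = ≼-trans P Q R p q
≼-trans {suc a} (U ∷ P) (D ∷ Q) (D ∷ R) p q = ≼-trans P Q R p q
≼-trans {a} {b} (D ∷ P) (D ∷ Q) (U ∷ R) p q =
  subst (P ≼[_] R) (ℕ.+-suc a b) (≼-trans P Q R p q)
≼-trans {suc a} {b} (U ∷ P) (D ∷ Q) (U ∷ R) p q =
  subst (P ≼[_] R) (ℕ.+-suc a b) (≼-trans P Q R p q)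
≼-trans {a} {suc b} (D ∷ P) (U ∷ Q) (D ∷ R) p q =
  subst (P ≼[_] R) (sym (ℕ.+-suc a b)) (≼-trans P Q R p q)
≼-trans {a} {suc b} (U ∷ P) (U ∷ Q) (D ∷ R) p q =
  subst (U ∷ P ≼[_] D ∷ R) (sym (ℕ.+-suc a b)) (≼-trans P Q R p q)

≼-interpolate : ∀ i j P Q → P ≼[ i + j ] Q → ∃[ T ] P ≼[ i ] T × T ≼[ j ] Q
≼-interpolate i       j       []      []      _ = [] , tt , tt
≼-interpolate i       j       (U ∷ P) (U ∷ Q) p = let T , l , r = ≼-interpolate i j P Q p in U ∷ T , l , r
≼-interpolate i       j       (D ∷ P) (D ∷ Q) p = let T , l , r = ≼-interpolate i j P Q p in D ∷ T , l , r
≼-interpolate i       j       (D ∷ P) (U ∷ Q) p = let T , l , r = ≼-interpolate (suc i) j P Q p in U ∷ T , l , r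
≼-interpolate (suc i) j       (U ∷ P) (D ∷ Q) p = let T , l , r = ≼-interpolate i j P Q p in D ∷ T , l , r
≼-interpolate zero    (suc j) (U ∷ P) (D ∷ Q) p = let T , l , r = ≼-interpolate 0 j P Q p in U ∷ T , l , r

≼-prefix : ∀ {c} X X′ {Y Y′} → length X ≡ length X′ → X ++ Y ≼[ c ] X′ ++ Y′ → X ≼[ c ] X′
≼-prefix []      []       _ _ = tt
≼-prefix (U ∷ X) (U ∷ X′) l p = ≼-prefix X X′ (ℕ.suc-injective l) p
≼-prefix (D ∷ X) (D ∷ X′) l p = ≼-prefix X X′ (ℕ.suc-injective l) p
≼-prefix (D ∷ X) (U ∷ X′) l p = ≼-prefix X X′ (ℕ.suc-injective l) p
≼-prefix {suc c} (U ∷ X) (D ∷ X′) l p = ≼-prefix X X′ (ℕ.suc-injective l) p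

-- The slack left after X ≼[ c ] X′ is the e with e + downs X′ ≡ c + downs X.
≼-++ : ∀ {c e} X X′ {Z Z′} → X ≼[ c ] X′ → Z ≼[ e ] Z′ → e + downs X′ ≡ c + downs X →
       X ++ Z ≼[ c ] X′ ++ Z′
≼-++ {c} {e} [] [] {Z} {Z′} _ z eq =
  subst (Z ≼[_] Z′) (ℕ.+-cancelʳ-≡ 0 e c eq) z
≼-++ (U ∷ X) (U ∷ X′) p z eq = ≼-++ X X′ p z eq
≼-++ {c} {e} (D ∷ X) (D ∷ X′) p z eq =
  ≼-++ X X′ p z (ℕ.suc-injective (trans (sym (ℕ.+-suc e _)) (trans eq (ℕ.+-suc c _))))
≼-++ {c} (D ∷ X) (U ∷ X′) p z eq = ≼-++ X X′ p z (trans eq (ℕ.+-suc c _))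
≼-++ {suc c} {e} (U ∷ X) (D ∷ X′) p z eq =
  ≼-++ X X′ p z (ℕ.suc-injective (trans (sym (ℕ.+-suc e _)) eq))

≼-downs : ∀ {c} P Q → P ≼[ c ] Q → downs Q ≤ c + downs P
≼-downs []      []      _ = z≤n
≼-downs (U ∷ P) (U ∷ Q) p = ≼-downs P Q p
≼-downs {c} (D ∷ P) (D ∷ Q) p =
  subst (suc (downs Q) ≤_) (sym (ℕ.+-suc c _)) (s≤s (≼-downs P Q p))
≼-downs {c} (D ∷ P) (U ∷ Q) p = subst (downs Q ≤_) (sym (ℕ.+-suc c _)) (≼-downs P Q p)
≼-downs {suc c} (U ∷ P) (D ∷ Q) p = s≤s (≼-downs P Q p)

lowest-≼ : ∀ i j {c} Q → length Q ≡ i + j → downs Q ≤ c + i → replicate i D ++ U^ j ≼[ c ] Q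
lowest-≼ zero    zero    []      _ _ = tt
lowest-≼ (suc i) j {c} (U ∷ Q) l d =
  lowest-≼ i j Q (ℕ.suc-injective l) (subst (downs Q ≤_) (ℕ.+-suc c i) d)
lowest-≼ (suc i) j {c} (D ∷ Q) l d =
  lowest-≼ i j Q (ℕ.suc-injective l) (ℕ.≤-pred (subst (suc (downs Q) ≤_) (ℕ.+-suc c i) d))
lowest-≼ zero (suc j) (U ∷ Q) l d = lowest-≼ zero j Q (ℕ.suc-injective l) d
lowest-≼ zero (suc j) {suc c} (D ∷ Q) l d = lowest-≼ zero j Q (ℕ.suc-injective l) (ℕ.≤-pred d)

heightsFrom : ℤ → Word → List ℤ
heightsFrom = scanl (λ h s → h ℤ.+ step s)

private
  head-≤ : ∀ {a b} P Q → Pointwise ℤ._≤_ (heightsFrom a P) (heightsFrom b Q) → a ℤ.≤ b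
  head-≤ []      []      (a≤b ∷ _) = a≤b
  head-≤ []      (_ ∷ _) (a≤b ∷ _) = a≤b
  head-≤ (_ ∷ _) []      (a≤b ∷ _) = a≤b
  head-≤ (_ ∷ _) (_ ∷ _) (a≤b ∷ _) = a≤b

  raise-UU : ∀ h y → (h ℤ.+ (y ℤ.+ y)) ℤ.+ + 1 ≡ (h ℤ.+ + 1) ℤ.+ (y ℤ.+ y)
  raise-UU = solve-∀
  raise-DD : ∀ h y → (h ℤ.+ (y ℤ.+ y)) ℤ.+ -[1+ 0 ] ≡ (h ℤ.+ -[1+ 0 ]) ℤ.+ (y ℤ.+ y)
  raise-DD = solve-∀
  raise-DU : ∀ h y →
             (h ℤ.+ (y ℤ.+ y)) ℤ.+ + 1 ≡ (h ℤ.+ -[1+ 0 ]) ℤ.+ ((+ 1 ℤ.+ y) ℤ.+ (+ 1 ℤ.+ y))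
  raise-DU = solve-∀
  raise-UD : ∀ h y →
             (h ℤ.+ ((+ 1 ℤ.+ y) ℤ.+ (+ 1 ℤ.+ y))) ℤ.+ -[1+ 0 ] ≡ (h ℤ.+ + 1) ℤ.+ (y ℤ.+ y)
  raise-UD = solve-∀

  h-1<h+1 : ∀ h → (h ℤ.+ (+ 0 ℤ.+ + 0)) ℤ.+ -[1+ 0 ] ℤ.< h ℤ.+ + 1
  h-1<h+1 h =
    subst (ℤ._< h ℤ.+ + 1) (cong (ℤ._+ -[1+ 0 ]) (sym (ℤ.+-identityʳ h))) (ℤ.+-monoʳ-< h ℤ.-<+)

-- The start heights are kept general (related by an equation rather than a substitution) so
-- that the induction can step along both height sequences.
Raised : ℕ → ℤ → ℤ → Set
Raised c h h′ = h′ ≡ h ℤ.+ (+ c ℤ.+ + c)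

pointwise⇒≼ : ∀ {c h h′} P Q → Raised c h h′ →
              Pointwise ℤ._≤_ (heightsFrom h P) (heightsFrom h′ Q) → P ≼[ c ] Q
pointwise⇒≼ [] [] _ _ = tt
pointwise⇒≼ {c} {h} (U ∷ P) (U ∷ Q) refl (_ ∷ ps) = pointwise⇒≼ P Q (raise-UU h (+ c)) ps
pointwise⇒≼ {c} {h} (D ∷ P) (D ∷ Q) refl (_ ∷ ps) = pointwise⇒≼ P Q (raise-DD h (+ c)) ps
pointwise⇒≼ {c} {h} (D ∷ P) (U ∷ Q) refl (_ ∷ ps) = pointwise⇒≼ P Q (raise-DU h (+ c)) ps
pointwise⇒≼ {suc c} {h} (U ∷ P) (D ∷ Q) refl (_ ∷ ps) = pointwise⇒≼ P Q (raise-UD h (+ c)) ps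
pointwise⇒≼ {zero} {h} (U ∷ P) (D ∷ Q) refl (_ ∷ ps) = ℤ.<⇒≱ (h-1<h+1 h) (head-≤ P Q ps)
pointwise⇒≼ [] (_ ∷ _) _ (_ ∷ ())
pointwise⇒≼ (_ ∷ _) [] _ (_ ∷ ())

≼⇒pointwise : ∀ {c h h′} P Q → Raised c h h′ →
              P ≼[ c ] Q → Pointwise ℤ._≤_ (heightsFrom h P) (heightsFrom h′ Q)
≼⇒pointwise {c} {h} [] [] refl _ = ℤ.i≤i+j h _ ∷ []
≼⇒pointwise {c} {h} (U ∷ P) (U ∷ Q) refl p = ℤ.i≤i+j h _ ∷ ≼⇒pointwise P Q (raise-UU h (+ c)) p
≼⇒pointwise {c} {h} (D ∷ P) (D ∷ Q) refl p = ℤ.i≤i+j h _ ∷ ≼⇒pointwise P Q (raise-DD h (+ c)) p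
≼⇒pointwise {c} {h} (D ∷ P) (U ∷ Q) refl p = ℤ.i≤i+j h _ ∷ ≼⇒pointwise P Q (raise-DU h (+ c)) p
≼⇒pointwise {suc c} {h} (U ∷ P) (D ∷ Q) refl p = ℤ.i≤i+j h _ ∷ ≼⇒pointwise P Q (raise-UD h (+ c)) p

≤St⇒≼ : ∀ P Q → P ≤St Q → P ≼ Q
≤St⇒≼ P Q = pointwise⇒≼ P Q (sym (ℤ.+-identityʳ (+ 0)))

≼⇒≤St : ∀ P Q → P ≼ Q → P ≤St Q
≼⇒≤St P Q = ≼⇒pointwise P Q (sym (ℤ.+-identityʳ (+ 0)))

-- DUU-avoiding Dyck paths are encoded words

data Walk : ℕ → ℕ → Word → Set where
  stop : ∀ {a} → Walk a a []
  up   : ∀ {a b w} → Walk (suc a) b w → Walk a b (U ∷ w)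
  down : ∀ {a b w} → Walk a b w → Walk (suc a) b (D ∷ w)

private
  +1-comm : ∀ y → y ℤ.+ + 1 ≡ + 1 ℤ.+ y
  +1-comm = solve-∀
  +1-1-cancel : ∀ y → (+ 1 ℤ.+ y) ℤ.+ -[1+ 0 ] ≡ y
  +1-1-cancel = solve-∀
  +1-assoc : ∀ y e → y ℤ.+ (+ 1 ℤ.+ e) ≡ (+ 1 ℤ.+ y) ℤ.+ e
  +1-assoc = solve-∀
  -1-assoc : ∀ y e → (+ 1 ℤ.+ y) ℤ.+ (-[1+ 0 ] ℤ.+ e) ≡ y ℤ.+ e
  -1-assoc = solve-∀

Walk⇒nonneg : ∀ {a b w} h → h ≡ + a → Walk a b w → All (ℤ._≤_ (+ 0)) (heightsFrom h w)
Walk⇒nonneg h refl stop = ℤ.+≤+ z≤n ∷ []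
Walk⇒nonneg {a} h refl (up p) = ℤ.+≤+ z≤n ∷ Walk⇒nonneg _ (+1-comm (+ a)) p
Walk⇒nonneg {suc a} h refl (down p) = ℤ.+≤+ z≤n ∷ Walk⇒nonneg _ (+1-1-cancel (+ a)) p

nonneg⇒Walk : ∀ {a} h w → h ≡ + a → All (ℤ._≤_ (+ 0)) (heightsFrom h w) → ∃[ b ] Walk a b w
nonneg⇒Walk h [] _ _ = _ , stop
nonneg⇒Walk {a} h (U ∷ w) refl (_ ∷ hs) =
  let b , p = nonneg⇒Walk _ w (+1-comm (+ a)) hs in b , up p
nonneg⇒Walk {suc a} h (D ∷ w) refl (_ ∷ hs) =
  let b , p = nonneg⇒Walk _ w (+1-1-cancel (+ a)) hs in b , down p
nonneg⇒Walk {zero} h (D ∷ []) refl (_ ∷ (() ∷ _))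
nonneg⇒Walk {zero} h (D ∷ _ ∷ _) refl (_ ∷ (() ∷ _))

Walk⇒endHeight : ∀ {a b w} → Walk a b w → + a ℤ.+ endHeight w ≡ + b
Walk⇒endHeight {a} stop = ℤ.+-identityʳ (+ a)
Walk⇒endHeight {a} {w = U ∷ w} (up p) = trans (+1-assoc (+ a) (endHeight w)) (Walk⇒endHeight p)
Walk⇒endHeight {suc a} {w = D ∷ w} (down p) =
  trans (-1-assoc (+ a) (endHeight w)) (Walk⇒endHeight p)

Walk-ascent : ∀ j {i b w} → Walk (j + i) b w → Walk i b (U^ j ++ w)
Walk-ascent zero p = p
Walk-ascent (suc j) {i} {b} {w} p =
  up (Walk-ascent j (subst (λ a → Walk a b w) (sym (ℕ.+-suc j i)) p))

DUU-free-ascent : ∀ j w → ¬ OccursIn DUU w → ¬ OccursIn DUU (U^ j ++ w)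
DUU-free-ascent zero w free occ = free occ
DUU-free-ascent (suc j) w free (here (() ∷ _))
DUU-free-ascent (suc j) w free (there occ) = DUU-free-ascent j w free occ

data Tokens : ℕ → Word → Set where
  []   : Tokens 0 []
  d∷_  : ∀ {k r} → Tokens k r → Tokens (suc k) (D ∷ r)
  ud∷_ : ∀ {k r} → Tokens k r → Tokens k (U ∷ D ∷ r)

Tokens⇒Walk : ∀ {k r} → Tokens k r → Walk k 0 r
Tokens⇒Walk []        = stop
Tokens⇒Walk (d∷ ts)  = down (Tokens⇒Walk ts)
Tokens⇒Walk (ud∷ ts) = up (down (Tokens⇒Walk ts))

Tokens⇒DUU-free : ∀ {k r} → Tokens k r → ¬ OccursIn DUU (D ∷ r)
Tokens⇒DUU-free []        (here (_ ∷ ()))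
Tokens⇒DUU-free []        (there (here ()))
Tokens⇒DUU-free (d∷ ts)  (here (_ ∷ () ∷ _))
Tokens⇒DUU-free (d∷ ts)  (there occ) = Tokens⇒DUU-free ts occ
Tokens⇒DUU-free (ud∷ ts) (here (_ ∷ _ ∷ () ∷ _))
Tokens⇒DUU-free (ud∷ ts) (there (here (() ∷ _)))
Tokens⇒DUU-free (ud∷ ts) (there (there occ)) = Tokens⇒DUU-free ts occ

parse-Tokens : ∀ k r → Walk k 0 r → ¬ OccursIn DUU (D ∷ r) → Tokens k r
parse-Tokens _ [] stop _ = []
parse-Tokens (suc k) (D ∷ r) (down p) free = d∷ parse-Tokens k r p (λ occ → free (there occ))
parse-Tokens k (U ∷ []) (up ()) _
parse-Tokens k (U ∷ U ∷ r) p free = ⊥-elim (free (here (refl ∷ refl ∷ refl ∷ [])))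
parse-Tokens k (U ∷ D ∷ r) (up (down p)) free =
  ud∷ parse-Tokens k r p (λ occ → free (there (there occ)))

parse-ascent : ∀ i w → Walk i 0 (U ∷ w) → ¬ OccursIn DUU (U ∷ w) →
               ∃[ k ] ∃[ r ] U ∷ w ≡ U^ suc k ++ D ∷ r × Tokens (i + k) r
parse-ascent i (D ∷ r) (up (down p)) free =
  0 , r , refl ,
  subst (λ k → Tokens k r) (sym (ℕ.+-identityʳ i)) (parse-Tokens i r p (λ occ → free (there occ)))
parse-ascent i (U ∷ w) (up p) free =
  let k , r , eq , ts = parse-ascent (suc i) w p (λ occ → free (there occ))
  in suc k , r , cong (U ∷_) eq , subst (λ k → Tokens k r) (sym (ℕ.+-suc i k)) ts

ups : Word → ℕ
ups []      = 0
ups (U ∷ w) = suc (ups w)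
ups (D ∷ w) = ups w

tokens : Word → Word
tokens []      = []
tokens (U ∷ t) = D ∷ tokens t
tokens (D ∷ t) = U ∷ D ∷ tokens t

encode : Word → Word
encode x = U^ suc (ups x) ++ D ∷ tokens (reverse x)

tokens⇒Tokens : ∀ t → Tokens (ups t) (tokens t)
tokens⇒Tokens []      = []
tokens⇒Tokens (U ∷ t) = d∷ tokens⇒Tokens t
tokens⇒Tokens (D ∷ t) = ud∷ tokens⇒Tokens t

Tokens⇒tokens : ∀ {k r} → Tokens k r → ∃[ t ] tokens t ≡ r × ups t ≡ k
Tokens⇒tokens [] = [] , refl , refl
Tokens⇒tokens (d∷ ts)  = let t , r≡ , k≡ = Tokens⇒tokens ts in U ∷ t , cong (D ∷_) r≡ , cong suc k≡
Tokens⇒tokens (ud∷ ts) = let t , r≡ , k≡ = Tokens⇒tokens ts in D ∷ t , cong (λ r → U ∷ D ∷ r) r≡ , k≡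

tokens-++ : ∀ s t → tokens (s ++ t) ≡ tokens s ++ tokens t
tokens-++ []      t = refl
tokens-++ (U ∷ s) t = cong (D ∷_) (tokens-++ s t)
tokens-++ (D ∷ s) t = cong (λ r → U ∷ D ∷ r) (tokens-++ s t)

ups-++ : ∀ s t → ups (s ++ t) ≡ ups s + ups t
ups-++ []      t = refl
ups-++ (U ∷ s) t = cong suc (ups-++ s t)
ups-++ (D ∷ s) t = ups-++ s t

downs-++ : ∀ s t → downs (s ++ t) ≡ downs s + downs t
downs-++ []      t = refl
downs-++ (U ∷ s) t = downs-++ s t
downs-++ (D ∷ s) t = cong suc (downs-++ s t)

ups-reverse : ∀ x → ups (reverse x) ≡ ups x
ups-reverse []      = refl
ups-reverse (a ∷ x) = begin
  ups (reverse (a ∷ x))          ≡⟨ cong ups (List.unfold-reverse a x) ⟩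
  ups (reverse x ++ a ∷ [])      ≡⟨ ups-++ (reverse x) (a ∷ []) ⟩
  ups (reverse x) + ups (a ∷ []) ≡⟨ ℕ.+-comm (ups (reverse x)) _ ⟩
  ups (a ∷ []) + ups (reverse x) ≡⟨ cong (ups (a ∷ []) ℕ.+_) (ups-reverse x) ⟩
  ups (a ∷ []) + ups x           ≡⟨ ups-++ (a ∷ []) x ⟨
  ups (a ∷ x)                    ∎
  where open ≡-Reasoning

encode-U : ∀ x → encode (U ∷ x) ≡ U ∷ (encode x ++ D ∷ [])
encode-U x = cong (U ∷_) (begin
  U^ suc (ups x) ++ D ∷ tokens (reverse (U ∷ x))
    ≡⟨ cong (λ r → U^ suc (ups x) ++ D ∷ tokens r) (List.unfold-reverse U x) ⟩
  U^ suc (ups x) ++ D ∷ tokens (reverse x ++ U ∷ [])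
    ≡⟨ cong (λ r → U^ suc (ups x) ++ D ∷ r) (tokens-++ (reverse x) (U ∷ [])) ⟩
  U^ suc (ups x) ++ D ∷ tokens (reverse x) ++ D ∷ []
    ≡⟨ List.++-assoc (U^ suc (ups x)) _ _ ⟨
  encode x ++ D ∷ [] ∎)
  where open ≡-Reasoning

encode-D : ∀ x → encode (D ∷ x) ≡ encode x ++ U ∷ D ∷ []
encode-D x = begin
  U^ suc (ups x) ++ D ∷ tokens (reverse (D ∷ x))
    ≡⟨ cong (λ r → U^ suc (ups x) ++ D ∷ tokens r) (List.unfold-reverse D x) ⟩
  U^ suc (ups x) ++ D ∷ tokens (reverse x ++ D ∷ [])
    ≡⟨ cong (λ r → U^ suc (ups x) ++ D ∷ r) (tokens-++ (reverse x) (D ∷ [])) ⟩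
  U^ suc (ups x) ++ D ∷ tokens (reverse x) ++ U ∷ D ∷ []
    ≡⟨ List.++-assoc (U^ suc (ups x)) _ _ ⟨
  encode x ++ U ∷ D ∷ [] ∎
  where open ≡-Reasoning

encode-length : ∀ x → length (encode x) ≡ 2 * suc (length x)
encode-length [] = refl
encode-length (U ∷ x) = begin
  length (encode (U ∷ x))           ≡⟨ cong length (encode-U x) ⟩
  suc (length (encode x ++ D ∷ [])) ≡⟨ cong suc (List.length-++ (encode x)) ⟩
  suc (length (encode x) + 1)       ≡⟨ cong (λ l → suc (l + 1)) (encode-length x) ⟩
  suc (2 * suc (length x) + 1)      ≡⟨ arith (length x) ⟩
  2 * suc (length (U ∷ x))          ∎
  where
  open ≡-Reasoning
  arith : ∀ n → suc (2 * suc n + 1) ≡ 2 * suc (suc n)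
  arith = ℕ-Solver.solve-∀
encode-length (D ∷ x) = begin
  length (encode (D ∷ x))            ≡⟨ cong length (encode-D x) ⟩
  length (encode x ++ U ∷ D ∷ [])    ≡⟨ List.length-++ (encode x) ⟩
  length (encode x) + 2              ≡⟨ cong (_+ 2) (encode-length x) ⟩
  2 * suc (length x) + 2             ≡⟨ arith (length x) ⟩
  2 * suc (length (D ∷ x))           ∎
  where
  open ≡-Reasoning
  arith : ∀ n → 2 * suc n + 2 ≡ 2 * suc (suc n)
  arith = ℕ-Solver.solve-∀

encode-downs : ∀ x → downs (encode x) ≡ suc (length x)
encode-downs [] = refl
encode-downs (U ∷ x) = begin
  downs (encode (U ∷ x))       ≡⟨ cong downs (encode-U x) ⟩
  downs (encode x ++ D ∷ [])   ≡⟨ downs-++ (encode x) (D ∷ []) ⟩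
  downs (encode x) + 1         ≡⟨ cong (_+ 1) (encode-downs x) ⟩
  suc (length x) + 1           ≡⟨ ℕ.+-comm (suc (length x)) 1 ⟩
  suc (length (U ∷ x))         ∎
  where open ≡-Reasoning
encode-downs (D ∷ x) = begin
  downs (encode (D ∷ x))         ≡⟨ cong downs (encode-D x) ⟩
  downs (encode x ++ U ∷ D ∷ []) ≡⟨ downs-++ (encode x) (U ∷ D ∷ []) ⟩
  downs (encode x) + 1           ≡⟨ cong (_+ 1) (encode-downs x) ⟩
  suc (length x) + 1             ≡⟨ ℕ.+-comm (suc (length x)) 1 ⟩
  suc (length (D ∷ x))           ∎
  where open ≡-Reasoning

encode-length-≡ : ∀ x y → length x ≡ length y → length (encode x) ≡ length (encode y)
encode-length-≡ x y l =
  trans (encode-length x) (trans (cong (λ n → 2 * suc n) l) (sym (encode-length y)))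

encode-downs-≡ : ∀ x y → length x ≡ length y → downs (encode x) ≡ downs (encode y)
encode-downs-≡ x y l = trans (encode-downs x) (trans (cong suc l) (sym (encode-downs y)))

encode-ends-with-D : ∀ x → ∃[ A ] encode x ≡ A ++ D ∷ []
encode-ends-with-D []      = U ∷ [] , refl
encode-ends-with-D (U ∷ x) = U ∷ encode x , encode-U x
encode-ends-with-D (D ∷ x) =
  encode x ++ U ∷ [] , trans (encode-D x) (sym (List.++-assoc (encode x) (U ∷ []) (D ∷ [])))

2*suc-injective : ∀ {a b} → 2 * suc a ≡ 2 * suc b → a ≡ b
2*suc-injective {a} {b} eq = ℕ.suc-injective (ℕ.*-cancelˡ-≡ (suc a) (suc b) 2 eq)

Dyck⇒Walk : ∀ {n} w → IsDyck n w → Walk 0 0 w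
Dyck⇒Walk w (_ , nonneg , end) =
  let b , walk = nonneg⇒Walk (+ 0) w refl nonneg
      b≡0 = ℤ.+-injective (trans (sym (Walk⇒endHeight walk)) (trans (ℤ.+-identityˡ _) end))
  in subst (λ b → Walk 0 b w) b≡0 walk

encode-IsF : ∀ x → IsF (suc (length x)) (encode x)
encode-IsF x =
  (encode-length x , Walk⇒nonneg (+ 0) refl walk , trans (sym (ℤ.+-identityˡ _)) (Walk⇒endHeight walk)) ,
  DUU-free-ascent (suc (ups x)) _ (Tokens⇒DUU-free ts)
  where
  ts : Tokens (ups x) (tokens (reverse x))
  ts = subst (λ k → Tokens k (tokens (reverse x))) (ups-reverse x) (tokens⇒Tokens (reverse x))
  walk : Walk 0 0 (encode x)
  walk = Walk-ascent (suc (ups x))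
    (subst (λ a → Walk a 0 (D ∷ tokens (reverse x))) (sym (ℕ.+-identityʳ _)) (down (Tokens⇒Walk ts)))

IsF⇒encode : ∀ m w → IsF (suc m) w → ∃[ x ] length x ≡ m × w ≡ encode x
IsF⇒encode m (U ∷ w) (dyck@(len , _) , free) =
  let k , r , w≡ , ts = parse-ascent 0 w (Dyck⇒Walk {suc m} (U ∷ w) dyck) free
      t , tokens≡ , ups≡ = Tokens⇒tokens ts
      encode≡ : encode (reverse t) ≡ U^ suc k ++ D ∷ r
      encode≡ = cong₂ (λ k r → U^ suc k ++ D ∷ r)
                      (trans (ups-reverse t) ups≡)
                      (trans (cong tokens (List.reverse-involutive t)) tokens≡)
      w≡encode = trans w≡ (sym encode≡)
      |x|≡m = 2*suc-injective (trans (sym (encode-length (reverse t))) (trans (cong length (sym w≡encode)) len))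
  in reverse t , |x|≡m , w≡encode
IsF⇒encode m (D ∷ w) (dyck , _) with Dyck⇒Walk {suc m} (D ∷ w) dyck
... | ()

-- encode is an order embedding

U^-∷ : ∀ k w → U^ k ++ U ∷ w ≡ U ∷ U^ k ++ w
U^-∷ zero    w = refl
U^-∷ (suc k) w = cong (U ∷_) (U^-∷ k w)

downs-U^ : ∀ k → downs (U^ k) ≡ 0
downs-U^ zero    = refl
downs-U^ (suc k) = downs-U^ k

downs-U^-++ : ∀ k w → downs (U^ k ++ w) ≡ downs w
downs-U^-++ zero    w = refl
downs-U^-++ (suc k) w = downs-U^-++ k w

length-U^-++ : ∀ k w → length (U^ k ++ w) ≡ k + length w
length-U^-++ zero    w = refl
length-U^-++ (suc k) w = cong suc (length-U^-++ k w)

DUᵏ≼UᵏD : ∀ k → D ∷ U^ k ≼ U^ k ++ D ∷ []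
DUᵏ≼UᵏD k = lowest-≼ 1 k (U^ k ++ D ∷ []) (trans (length-U^-++ k _) (ℕ.+-comm k 1))
                                         (ℕ.≤-reflexive (downs-U^-++ k _))

DUUᵏ≼UᵏUD : ∀ k → D ∷ U ∷ U^ k ≼ U^ k ++ U ∷ D ∷ []
DUUᵏ≼UᵏUD k = lowest-≼ 1 (suc k) (U^ k ++ U ∷ D ∷ []) (trans (length-U^-++ k _) (ℕ.+-comm k 2))
                                                     (ℕ.≤-reflexive (downs-U^-++ k _))

UDUᵏ≼UᵏUD : ∀ k → U ∷ D ∷ U^ k ≼ U^ k ++ U ∷ D ∷ []
UDUᵏ≼UᵏUD k = subst (U ∷ D ∷ U^ k ≼_) (sym (U^-∷ k (D ∷ []))) (DUᵏ≼UᵏD k)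

-- Comparing A ++ Z with X ++ Y ++ W only needs
-- A ≼ X, after which the slack is downs Y by counting down-steps; Uᵏ is the lowest tail for that
-- slack, so it can be exchanged for any Z lying below Uᵏ ++ W.
module Shift (k : ℕ) (A B : Word) (|A|≡|B| : length A ≡ length B) (downs≡ : downs A ≡ downs B) where

  private
    X = take (length A) (U^ k ++ B)
    Y = drop (length A) (U^ k ++ B)

    |UᵏB| : length (U^ k ++ B) ≡ k + length A
    |UᵏB| = trans (length-U^-++ k B) (cong (k ℕ.+_) (sym |A|≡|B|))

    |X| : length A ≡ length X
    |X| = sym (trans (List.length-take (length A) _)
                     (ℕ.m≤n⇒m⊓n≡m (subst (length A ≤_) (sym |UᵏB|) (ℕ.m≤n+m (length A) k))))

    |Y| : length Y ≡ 0 + k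
    |Y| = trans (List.length-drop (length A) _)
                (trans (cong (_∸ length A) |UᵏB|) (ℕ.m+n∸n≡m k (length A)))

    split₀ : U^ k ++ B ≡ X ++ Y
    split₀ = sym (List.take++drop≡id (length A) _)

    split : ∀ W → U^ k ++ B ++ W ≡ X ++ Y ++ W
    split W = trans (sym (List.++-assoc (U^ k) B W))
                    (trans (cong (_++ W) split₀) (List.++-assoc X Y W))

    slack : downs Y + downs X ≡ 0 + downs A
    slack = begin
      downs Y + downs X      ≡⟨ ℕ.+-comm (downs Y) _ ⟩
      downs X + downs Y      ≡⟨ downs-++ X Y ⟨
      downs (X ++ Y)         ≡⟨ cong downs split₀ ⟨
      downs (U^ k ++ B)      ≡⟨ downs-U^-++ k B ⟩
      downs B                ≡⟨ downs≡ ⟨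
      downs A             ∎
      where open ≡-Reasoning

    Uᵏ≼Y : U^ k ≼[ downs Y ] Y
    Uᵏ≼Y = lowest-≼ 0 k Y |Y| (ℕ.≤-reflexive (sym (ℕ.+-identityʳ _)))

  shift⇒ : ∀ {Z W} → A ++ U^ k ≼ U^ k ++ B → Z ≼ U^ k ++ W → A ++ Z ≼ U^ k ++ B ++ W
  shift⇒ {Z} {W} p z = subst (A ++ Z ≼_) (sym (split W)) (≼-++ A X A≼X Z≼YW slack)
    where
    A≼X : A ≼ X
    A≼X = ≼-prefix A X |X| (subst (A ++ U^ k ≼_) split₀ p)
    Z≼YW : Z ≼[ downs Y ] Y ++ W
    Z≼YW = ≼-trans Z (U^ k ++ W) (Y ++ W) z (≼-++ (U^ k) Y Uᵏ≼Y (≼-refl W) no-downs)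
      where
      no-downs : 0 + downs Y ≡ downs Y + downs (U^ k)
      no-downs = sym (trans (cong (downs Y ℕ.+_) (downs-U^ k)) (ℕ.+-identityʳ _))

  shift⇐ : ∀ {Z W} → A ++ Z ≼ U^ k ++ B ++ W → A ++ U^ k ≼ U^ k ++ B
  shift⇐ {Z} {W} p = subst (A ++ U^ k ≼_) (sym split₀)
                       (≼-++ A X (≼-prefix A X |X| (subst (A ++ Z ≼_) (split W) p)) Uᵏ≼Y slack)

encode-U-++ : ∀ x w → encode (U ∷ x) ++ w ≡ U ∷ encode x ++ D ∷ w
encode-U-++ x w =
  trans (cong (_++ w) (encode-U x)) (cong (U ∷_) (List.++-assoc (encode x) (D ∷ []) w))

encode-D-++ : ∀ x w → encode (D ∷ x) ++ w ≡ encode x ++ U ∷ D ∷ w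
encode-D-++ x w = trans (cong (_++ w) (encode-D x)) (List.++-assoc (encode x) (U ∷ D ∷ []) w)

U^-encode-U : ∀ k y → U^ k ++ encode (U ∷ y) ≡ U ∷ U^ k ++ encode y ++ D ∷ []
U^-encode-U k y = trans (cong (U^ k ++_) (encode-U y)) (U^-∷ k _)

U^-encode-D : ∀ k y → U^ k ++ encode (D ∷ y) ≡ U^ k ++ encode y ++ U ∷ D ∷ []
U^-encode-D k y = cong (U^ k ++_) (encode-D y)

module EncodeShift (k : ℕ) (x y : Word) (l : length x ≡ length y) =
  Shift k (encode x) (encode y) (encode-length-≡ x y l) (encode-downs-≡ x y l)

-- Appending Uᵏ to one encoding and prepending it to the other moves them k steps apart
-- diagonally, which realises the slack k.
encode-≼⇒ : ∀ k x y → length x ≡ length y → x ≼[ k ] y → encode x ++ U^ k ≼ U^ k ++ encode y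
encode-≼⇒ k [] [] _ _ = UDUᵏ≼UᵏUD k
encode-≼⇒ k (U ∷ x) (U ∷ y) l p =
  subst₂ _≼_ (sym (encode-U-++ x (U^ k))) (sym (U^-encode-U k y))
    (EncodeShift.shift⇒ k x y l′ (encode-≼⇒ k x y l′ p) (DUᵏ≼UᵏD k))
  where l′ = ℕ.suc-injective l
encode-≼⇒ k (D ∷ x) (D ∷ y) l p =
  subst₂ _≼_ (sym (encode-D-++ x (U^ k))) (sym (U^-encode-D k y))
    (EncodeShift.shift⇒ k x y l′ (encode-≼⇒ k x y l′ p) (UDUᵏ≼UᵏUD k))
  where l′ = ℕ.suc-injective l
encode-≼⇒ k (D ∷ x) (U ∷ y) l p =
  subst₂ _≼_ (sym (encode-D-++ x (U^ k))) (sym (U^-encode-U k y))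
    (EncodeShift.shift⇒ (suc k) x y l′ (encode-≼⇒ (suc k) x y l′ p) (DUᵏ≼UᵏD k))
  where l′ = ℕ.suc-injective l
encode-≼⇒ (suc k) (U ∷ x) (D ∷ y) l p =
  subst₂ _≼_ (sym (encode-U-++ x (U^ suc k))) (cong (U ∷_) (sym (U^-encode-D k y)))
    (EncodeShift.shift⇒ k x y l′ (encode-≼⇒ k x y l′ p) (DUUᵏ≼UᵏUD k))
  where l′ = ℕ.suc-injective l

-- encode (U ∷ x) ends with DD, encode (D ∷ y) with UD: two steps before the end the latter is lower.
encode-U⋠encode-D : ∀ x y → length x ≡ length y → ¬ encode (U ∷ x) ≼ encode (D ∷ y)
encode-U⋠encode-D x y l p = ℕ.1+n≰n (begin
  1 + downs A₁         ≡⟨ ℕ.+-comm 1 (downs A₁) ⟩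
  downs A₁ + 1         ≡⟨ downs-++ A₁ (D ∷ []) ⟨
  downs (A₁ ++ D ∷ []) ≡⟨ cong downs x≡ ⟨
  downs (encode x)     ≡⟨ encode-downs-≡ x y l ⟩
  downs (encode y)     ≤⟨ ≼-downs (U ∷ A₁) (encode y) (≼-prefix (U ∷ A₁) (encode y) |UA₁| p′) ⟩
  downs A₁             ∎)
  where
  open ℕ.≤-Reasoning
  A₁ = proj₁ (encode-ends-with-D x)
  x≡ = proj₂ (encode-ends-with-D x)
  p′ : (U ∷ A₁) ++ D ∷ D ∷ [] ≼ encode y ++ U ∷ D ∷ []
  p′ = subst₂ _≼_ (trans (encode-U x) (cong (U ∷_) ends-with-DD)) (encode-D y) p
    where
    ends-with-DD : encode x ++ D ∷ [] ≡ A₁ ++ D ∷ D ∷ []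
    ends-with-DD = trans (cong (_++ D ∷ []) x≡) (List.++-assoc A₁ (D ∷ []) (D ∷ []))
  |UA₁| : length (U ∷ A₁) ≡ length (encode y)
  |UA₁| = begin-equality
    suc (length A₁)         ≡⟨ ℕ.+-comm 1 (length A₁) ⟩
    length A₁ + 1           ≡⟨ List.length-++ A₁ ⟨
    length (A₁ ++ D ∷ [])   ≡⟨ cong length x≡ ⟨
    length (encode x)       ≡⟨ encode-length-≡ x y l ⟩
    length (encode y)       ∎

encode-≼⇐ : ∀ k x y → length x ≡ length y → encode x ++ U^ k ≼ U^ k ++ encode y → x ≼[ k ] y
encode-≼⇐ k [] [] _ _ = tt
encode-≼⇐ k (U ∷ x) (U ∷ y) l p =
  encode-≼⇐ k x y l′ (EncodeShift.shift⇐ k x y l′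
    (subst₂ _≼_ (encode-U-++ x (U^ k)) (U^-encode-U k y) p))
  where l′ = ℕ.suc-injective l
encode-≼⇐ k (D ∷ x) (D ∷ y) l p =
  encode-≼⇐ k x y l′ (EncodeShift.shift⇐ k x y l′
    (subst₂ _≼_ (encode-D-++ x (U^ k)) (U^-encode-D k y) p))
  where l′ = ℕ.suc-injective l
encode-≼⇐ k (D ∷ x) (U ∷ y) l p =
  encode-≼⇐ (suc k) x y l′ (EncodeShift.shift⇐ (suc k) x y l′
    (subst₂ _≼_ (encode-D-++ x (U^ k)) (U^-encode-U k y) p))
  where l′ = ℕ.suc-injective l
encode-≼⇐ (suc k) (U ∷ x) (D ∷ y) l p =
  encode-≼⇐ k x y l′ (EncodeShift.shift⇐ k x y l′
    (subst₂ _≼_ (encode-U-++ x (U^ suc k)) (cong (U ∷_) (U^-encode-D k y)) p))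
  where l′ = ℕ.suc-injective l
encode-≼⇐ zero (U ∷ x) (D ∷ y) l p =
  ⊥-elim (encode-U⋠encode-D x y (ℕ.suc-injective l)
            (subst (_≼ encode (D ∷ y)) (List.++-identityʳ (encode (U ∷ x))) p))

≼⇒encode-≤St : ∀ x y → length x ≡ length y → x ≼ y → encode x ≤St encode y
≼⇒encode-≤St x y l p =
  ≼⇒≤St (encode x) (encode y) (subst (_≼ encode y) (List.++-identityʳ (encode x)) (encode-≼⇒ 0 x y l p))

encode-≤St⇒≼ : ∀ x y → length x ≡ length y → encode x ≤St encode y → x ≼ y
encode-≤St⇒≼ x y l p =
  encode-≼⇐ 0 x y l (subst (_≼ encode y) (sym (List.++-identityʳ (encode x))) (≤St⇒≼ (encode x) (encode y) p))

encode-injective : ∀ {x y} → encode x ≡ encode y → x ≡ y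
encode-injective {x} {y} eq = ≼-antisym x y
  (encode-≤St⇒≼ x y l (subst (encode x ≤St_) eq ≤St-refl))
  (encode-≤St⇒≼ y x (sym l) (subst (_≤St encode x) eq ≤St-refl))
  where
  ≤St-refl : encode x ≤St encode x
  ≤St-refl = ≼⇒≤St (encode x) (encode x) (≼-refl (encode x))
  l : length x ≡ length y
  l = 2*suc-injective (trans (sym (encode-length x)) (trans (cong length eq) (encode-length y)))

-- Chains in the order of words

Between : ℕ → ℕ → Word → Word → Word → Set
Between i j x y w = x ≼[ i ] w × w ≼[ j ] y

IsChain : (Word → Set) → Set
IsChain X = ∀ r s → X r → X s → r ≼ s ⊎ s ≼ r

AllBelow : ℕ → (Word → Set) → (Word → Set) → Set
AllBelow k X Y = ∀ a b → X a → Y b → a ≼[ k ] b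

AtMostOne : (Word → Set) → Set
AtMostOne X = AllBelow 0 X X

chain-by-head : ∀ {X} → ¬ X [] → IsChain (X ∘ (D ∷_)) → IsChain (X ∘ (U ∷_)) →
                AllBelow 1 (X ∘ (D ∷_)) (X ∘ (U ∷_)) → IsChain X
chain-by-head ¬X[] _ _ _ [] _ p _ = ⊥-elim (¬X[] p)
chain-by-head ¬X[] _ _ _ (_ ∷ _) [] _ q = ⊥-elim (¬X[] q)
chain-by-head _ chainD _ _ (D ∷ r) (D ∷ s) p q = chainD r s p q
chain-by-head _ _ chainU _ (U ∷ r) (U ∷ s) p q = chainU r s p q
chain-by-head _ _ _ D≼U (D ∷ r) (U ∷ s) p q = inj₁ (D≼U r s p q)
chain-by-head _ _ _ D≼U (U ∷ r) (D ∷ s) p q = inj₂ (D≼U s r q p)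

between-self : ∀ u → AtMostOne (Between 0 0 u u)
between-self u a b (u≼a , a≼u) (u≼b , _) = subst (_≼ b) (≼-antisym u a u≼a a≼u) u≼b

≼[1]-short : ∀ r s → length r ≡ length s → length r ≤ 1 → r ≼[ 1 ] s
≼[1]-short []      []      _ _ = tt
≼[1]-short (U ∷ []) (U ∷ []) _ _ = tt
≼[1]-short (U ∷ []) (D ∷ []) _ _ = tt
≼[1]-short (D ∷ []) (U ∷ []) _ _ = tt
≼[1]-short (D ∷ []) (D ∷ []) _ _ = tt
≼[1]-short (_ ∷ _ ∷ _) (_ ∷ _ ∷ _) _ (s≤s ())

≼-total-short : ∀ r s → length r ≡ length s → length r ≤ 2 → r ≼ s ⊎ s ≼ r
≼-total-short []      []      _ _ = inj₁ tt
≼-total-short (U ∷ r) (U ∷ s) l (s≤s r≤1) = ≼-total-short r s (ℕ.suc-injective l) (ℕ.m≤n⇒m≤1+n r≤1)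
≼-total-short (D ∷ r) (D ∷ s) l (s≤s r≤1) = ≼-total-short r s (ℕ.suc-injective l) (ℕ.m≤n⇒m≤1+n r≤1)
≼-total-short (D ∷ r) (U ∷ s) l (s≤s r≤1) = inj₁ (≼[1]-short r s (ℕ.suc-injective l) r≤1)
≼-total-short (U ∷ r) (D ∷ s) l (s≤s r≤1) =
  inj₂ (≼[1]-short s r (sym (ℕ.suc-injective l)) (subst (_≤ 1) (ℕ.suc-injective l) r≤1))

short-chain : ∀ {i j} x y → length x ≤ 2 → IsChain (Between i j x y)
short-chain x y x≤2 r s (x≼r , _) (x≼s , _) =
  ≼-total-short r s (trans (sym (≼-length x r x≼r)) (≼-length x s x≼s))
                    (subst (_≤ 2) (≼-length x r x≼r) x≤2)

between-both-heads : ∀ a u b v → a ∷ u ≼[ 2 ] b ∷ v →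
  ∃[ t ] ∃[ t′ ] Between 1 1 (a ∷ u) (b ∷ v) (U ∷ t) × Between 1 1 (a ∷ u) (b ∷ v) (D ∷ t′)
between-both-heads U u U v p =
  let t , u≼t , t≼v = ≼-interpolate 1 1 u v p in t , u , (u≼t , t≼v) , (≼-refl u , p)
between-both-heads D u D v p =
  let t , u≼t , t≼v = ≼-interpolate 1 1 u v p in v , t , (p , ≼-refl v) , (u≼t , t≼v)
between-both-heads D u U v p =
  let t  , u≼t  , t≼v  = ≼-interpolate 2 1 u v p
      t′ , u≼t′ , t′≼v = ≼-interpolate 1 2 u v p
  in t , t′ , (u≼t , t≼v) , (u≼t′ , t′≼v)
between-both-heads U u D v p = v , u , (p , ≼-refl v) , (≼-refl u , p)

fork-lower≼upper : ∀ {u v} → IsChain (Between 0 0 (D ∷ u) (U ∷ v)) →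
                   AllBelow 1 (Between 0 1 u v) (Between 1 0 u v)
fork-lower≼upper chain a b p q = [ id , ⊥-elim ]′ (chain (D ∷ a) (U ∷ b) p q)

fork-UD⇒ : ∀ u v → u ≼ v → IsChain (Between 0 0 (D ∷ U ∷ u) (U ∷ D ∷ v)) → u ≡ v
fork-UD⇒ u v u≼v chain =
  [ ⊥-elim , ≼-antisym u v u≼v ]′ (chain (U ∷ D ∷ u) (D ∷ U ∷ v) (≼-refl u , u≼v) (u≼v , ≼-refl v))

fork-UD⇐ : ∀ u → IsChain (Between 0 0 (D ∷ U ∷ u) (U ∷ D ∷ u))
fork-UD⇐ u (D ∷ U ∷ a) (D ∷ U ∷ b) p q = inj₁ (between-self u _ _ p q)
fork-UD⇐ u (D ∷ U ∷ a) (U ∷ D ∷ b) p q = inj₁ (between-self u _ _ p q)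
fork-UD⇐ u (U ∷ D ∷ a) (D ∷ U ∷ b) p q = inj₂ (between-self u _ _ q p)
fork-UD⇐ u (U ∷ D ∷ a) (U ∷ D ∷ b) p q = inj₁ (between-self u _ _ p q)

fork-DU⇒ : ∀ u v → u ≼[ 2 ] v → IsChain (Between 0 0 (D ∷ D ∷ u) (U ∷ U ∷ v)) → u ≡ []
fork-DU⇒ []      _       _ _     = refl
fork-DU⇒ (U ∷ _) []      () _
fork-DU⇒ (D ∷ _) []      () _
fork-DU⇒ (a ∷ u) (b ∷ v) p chain =
  let t , t′ , Ut∈ , Dt′∈ = between-both-heads a u b v p
  in [ ⊥-elim , ⊥-elim ]′ (chain (D ∷ U ∷ U ∷ t) (U ∷ D ∷ D ∷ t′) Ut∈ Dt′∈)

-- The words of [D U u, U U v] are D U a and U D a for a in Between 0 1 u v, and U U a for a in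
-- Between 1 0 u v.
fork-UU⇒ : ∀ u v → IsChain (Between 0 0 (D ∷ U ∷ u) (U ∷ U ∷ v)) →
           IsChain (Between 0 0 (D ∷ u) (U ∷ v)) × AtMostOne (Between 0 1 u v)
fork-UU⇒ u v chain =
  chain-by-head (λ ())
    (λ r s → chain (D ∷ U ∷ r) (D ∷ U ∷ s))
    (λ r s → chain (U ∷ U ∷ r) (U ∷ U ∷ s))
                (λ a b p q → [ id , ⊥-elim ]′ (chain (D ∷ U ∷ a) (U ∷ U ∷ b) p q))
  , λ a b p q → [ id , ⊥-elim ]′ (chain (D ∷ U ∷ a) (U ∷ D ∷ b) p q)

fork-UU⇐ : ∀ u v → IsChain (Between 0 0 (D ∷ u) (U ∷ v)) → AtMostOne (Between 0 1 u v) →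
           IsChain (Between 0 0 (D ∷ U ∷ u) (U ∷ U ∷ v))
fork-UU⇐ u v chain one (D ∷ U ∷ a) (D ∷ U ∷ b) p q = chain (D ∷ a) (D ∷ b) p q
fork-UU⇐ u v chain one (D ∷ U ∷ a) (U ∷ D ∷ b) p q = inj₁ (one _ _ p q)
fork-UU⇐ u v chain one (D ∷ U ∷ a) (U ∷ U ∷ b) p q = inj₁ (fork-lower≼upper {u} {v} chain _ _ p q)
fork-UU⇐ u v chain one (U ∷ D ∷ a) (D ∷ U ∷ b) p q = inj₂ (one _ _ q p)
fork-UU⇐ u v chain one (U ∷ D ∷ a) (U ∷ D ∷ b) p q = inj₁ (one _ _ p q)
fork-UU⇐ u v chain one (U ∷ D ∷ a) (U ∷ U ∷ b) p q = inj₁ (fork-lower≼upper {u} {v} chain _ _ p q)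
fork-UU⇐ u v chain one (U ∷ U ∷ a) (D ∷ U ∷ b) p q = inj₂ (fork-lower≼upper {u} {v} chain _ _ q p)
fork-UU⇐ u v chain one (U ∷ U ∷ a) (U ∷ D ∷ b) p q = inj₂ (fork-lower≼upper {u} {v} chain _ _ q p)
fork-UU⇐ u v chain one (U ∷ U ∷ a) (U ∷ U ∷ b) p q = chain (U ∷ a) (U ∷ b) p q

-- The words of [D D u, U D v] are D D a for a in Between 0 1 u v, and D U a and U D a for a in
-- Between 1 0 u v.
fork-DD⇒ : ∀ u v → IsChain (Between 0 0 (D ∷ D ∷ u) (U ∷ D ∷ v)) →
           IsChain (Between 0 0 (D ∷ u) (U ∷ v)) × AtMostOne (Between 1 0 u v)
fork-DD⇒ u v chain =
  chain-by-head (λ ())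
    (λ r s → chain (D ∷ D ∷ r) (D ∷ D ∷ s))
    (λ r s → chain (D ∷ U ∷ r) (D ∷ U ∷ s))
                (λ a b p q → [ id , ⊥-elim ]′ (chain (D ∷ D ∷ a) (D ∷ U ∷ b) p q))
  , λ a b p q → [ id , ⊥-elim ]′ (chain (D ∷ U ∷ a) (U ∷ D ∷ b) p q)

fork-DD⇐ : ∀ u v → IsChain (Between 0 0 (D ∷ u) (U ∷ v)) → AtMostOne (Between 1 0 u v) →
           IsChain (Between 0 0 (D ∷ D ∷ u) (U ∷ D ∷ v))
fork-DD⇐ u v chain one (D ∷ D ∷ a) (D ∷ D ∷ b) p q = chain (D ∷ a) (D ∷ b) p q
fork-DD⇐ u v chain one (D ∷ D ∷ a) (D ∷ U ∷ b) p q = inj₁ (fork-lower≼upper {u} {v} chain _ _ p q)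
fork-DD⇐ u v chain one (D ∷ D ∷ a) (U ∷ D ∷ b) p q = inj₁ (fork-lower≼upper {u} {v} chain _ _ p q)
fork-DD⇐ u v chain one (D ∷ U ∷ a) (D ∷ D ∷ b) p q = inj₂ (fork-lower≼upper {u} {v} chain _ _ q p)
fork-DD⇐ u v chain one (D ∷ U ∷ a) (D ∷ U ∷ b) p q = chain (U ∷ a) (U ∷ b) p q
fork-DD⇐ u v chain one (D ∷ U ∷ a) (U ∷ D ∷ b) p q = inj₁ (one _ _ p q)
fork-DD⇐ u v chain one (U ∷ D ∷ a) (D ∷ D ∷ b) p q = inj₂ (fork-lower≼upper {u} {v} chain _ _ q p)
fork-DD⇐ u v chain one (U ∷ D ∷ a) (D ∷ U ∷ b) p q = inj₂ (one _ _ q p)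
fork-DD⇐ u v chain one (U ∷ D ∷ a) (U ∷ D ∷ b) p q = inj₁ (one _ _ p q)

_≟W_ : (u v : Word) → Dec (u ≡ v)
_≟W_ = List.≡-dec _≟S_

does⇒ : ∀ {P : Set} (P? : Dec P) → T (does P?) → P
does⇒ (yes p) _ = p

⇒does : ∀ {P : Set} (P? : Dec P) → P → T (does P?)
⇒does (yes _) _ = tt
⇒does (no ¬p) p = ¬p p

atMostOne₀₁ᵇ : Word → Word → Bool
atMostOne₀₁ᵇ []      []      = true
atMostOne₀₁ᵇ (U ∷ u) (U ∷ v) = atMostOne₀₁ᵇ u v
atMostOne₀₁ᵇ (U ∷ u) (D ∷ v) = does (u ≟W v)
atMostOne₀₁ᵇ _       _       = false

atMostOne₁₀ᵇ : Word → Word → Bool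
atMostOne₁₀ᵇ []      []      = true
atMostOne₁₀ᵇ (D ∷ u) (D ∷ v) = atMostOne₁₀ᵇ u v
atMostOne₁₀ᵇ (U ∷ u) (D ∷ v) = does (u ≟W v)
atMostOne₁₀ᵇ _       _       = false

forkᵇ : Word → Word → Bool
forkᵇ []      []      = true
forkᵇ (U ∷ u) (D ∷ v) = does (u ≟W v)
forkᵇ (D ∷ u) (U ∷ v) = null u
forkᵇ (U ∷ u) (U ∷ v) = atMostOne₀₁ᵇ u v
forkᵇ (D ∷ u) (D ∷ v) = atMostOne₁₀ᵇ u v
forkᵇ _       _       = false

linearᵇ : Word → Word → Bool
linearᵇ []      []      = true
linearᵇ (U ∷ x) (U ∷ y) = linearᵇ x y
linearᵇ (D ∷ x) (D ∷ y) = linearᵇ x y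
linearᵇ (D ∷ u) (U ∷ v) = forkᵇ u v
linearᵇ _       _       = false

atMostOne₀₁⇒ : ∀ u v → u ≼[ 1 ] v → AtMostOne (Between 0 1 u v) → T (atMostOne₀₁ᵇ u v)
atMostOne₀₁⇒ []      []      _ _   = tt
atMostOne₀₁⇒ (U ∷ u) (U ∷ v) p one = atMostOne₀₁⇒ u v p (λ a b → one (U ∷ a) (U ∷ b))
atMostOne₀₁⇒ (U ∷ u) (D ∷ v) p one =
  ⇒does (u ≟W v) (≼-antisym u v p (one (U ∷ v) (U ∷ u) (p , ≼-refl v) (≼-refl u , p)))
atMostOne₀₁⇒ (D ∷ u) (D ∷ v) p one = one (U ∷ v) (D ∷ u) (p , ≼-refl v) (≼-refl u , p)
atMostOne₀₁⇒ (D ∷ u) (U ∷ v) p one =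
  let t , u≼t , t≼v = ≼-interpolate 1 1 u v p in one (U ∷ t) (D ∷ u) (u≼t , t≼v) (≼-refl u , p)

atMostOne₀₁⇐ : ∀ u v → T (atMostOne₀₁ᵇ u v) → AtMostOne (Between 0 1 u v)
atMostOne₀₁⇐ []      []      _ [] [] _ _ = tt
atMostOne₀₁⇐ (U ∷ u) (U ∷ v) t (U ∷ a) (U ∷ b) p q = atMostOne₀₁⇐ u v t a b p q
atMostOne₀₁⇐ (U ∷ u) (D ∷ v) t (U ∷ a) (U ∷ b) p q with does⇒ (u ≟W v) t
... | refl = between-self u a b p q

atMostOne₁₀⇒ : ∀ u v → u ≼[ 1 ] v → AtMostOne (Between 1 0 u v) → T (atMostOne₁₀ᵇ u v)
atMostOne₁₀⇒ []      []      _ _   = tt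
atMostOne₁₀⇒ (D ∷ u) (D ∷ v) p one = atMostOne₁₀⇒ u v p (λ a b → one (D ∷ a) (D ∷ b))
atMostOne₁₀⇒ (U ∷ u) (D ∷ v) p one =
  ⇒does (u ≟W v) (≼-antisym u v p (one (D ∷ v) (D ∷ u) (p , ≼-refl v) (≼-refl u , p)))
atMostOne₁₀⇒ (U ∷ u) (U ∷ v) p one = one (U ∷ v) (D ∷ u) (p , ≼-refl v) (≼-refl u , p)
atMostOne₁₀⇒ (D ∷ u) (U ∷ v) p one =
  let t , u≼t , t≼v = ≼-interpolate 1 1 u v p in one (U ∷ v) (D ∷ t) (p , ≼-refl v) (u≼t , t≼v)

atMostOne₁₀⇐ : ∀ u v → T (atMostOne₁₀ᵇ u v) → AtMostOne (Between 1 0 u v)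
atMostOne₁₀⇐ []      []      _ [] [] _ _ = tt
atMostOne₁₀⇐ (D ∷ u) (D ∷ v) t (D ∷ a) (D ∷ b) p q = atMostOne₁₀⇐ u v t a b p q
atMostOne₁₀⇐ (U ∷ u) (D ∷ v) t (D ∷ a) (D ∷ b) p q with does⇒ (u ≟W v) t
... | refl = between-self u a b p q

atMostOne₀₁ᵇ⇒forkᵇ : ∀ u v → T (atMostOne₀₁ᵇ u v) → T (forkᵇ u v)
atMostOne₀₁ᵇ⇒forkᵇ []      []      t = t
atMostOne₀₁ᵇ⇒forkᵇ (U ∷ u) (U ∷ v) t = t
atMostOne₀₁ᵇ⇒forkᵇ (U ∷ u) (D ∷ v) t = t

atMostOne₁₀ᵇ⇒forkᵇ : ∀ u v → T (atMostOne₁₀ᵇ u v) → T (forkᵇ u v)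
atMostOne₁₀ᵇ⇒forkᵇ []      []      t = t
atMostOne₁₀ᵇ⇒forkᵇ (D ∷ u) (D ∷ v) t = t
atMostOne₁₀ᵇ⇒forkᵇ (U ∷ u) (D ∷ v) t = t

fork⇒ : ∀ u v → u ≼[ 1 ] v → IsChain (Between 0 0 (D ∷ u) (U ∷ v)) → T (forkᵇ u v)
fork⇒ []      []      _ _     = tt
fork⇒ (U ∷ u) (D ∷ v) p chain = ⇒does (u ≟W v) (fork-UD⇒ u v p chain)
fork⇒ (D ∷ u) (U ∷ v) p chain = subst (T ∘ null) (sym (fork-DU⇒ u v p chain)) tt
fork⇒ (U ∷ u) (U ∷ v) p chain = atMostOne₀₁⇒ u v p (proj₂ (fork-UU⇒ u v chain))
fork⇒ (D ∷ u) (D ∷ v) p chain = atMostOne₁₀⇒ u v p (proj₂ (fork-DD⇒ u v chain))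

fork⇐ : ∀ u v → T (forkᵇ u v) → IsChain (Between 0 0 (D ∷ u) (U ∷ v))
fork⇐ []       []      _ = short-chain (D ∷ []) (U ∷ []) (s≤s z≤n)
fork⇐ (U ∷ u)  (D ∷ v) t with does⇒ (u ≟W v) t
... | refl = fork-UD⇐ u
fork⇐ (D ∷ []) (U ∷ v) _ = short-chain (D ∷ D ∷ []) (U ∷ U ∷ v) (s≤s (s≤s z≤n))
fork⇐ (U ∷ u)  (U ∷ v) t = fork-UU⇐ u v (fork⇐ u v (atMostOne₀₁ᵇ⇒forkᵇ u v t)) (atMostOne₀₁⇐ u v t)
fork⇐ (D ∷ u)  (D ∷ v) t = fork-DD⇐ u v (fork⇐ u v (atMostOne₁₀ᵇ⇒forkᵇ u v t)) (atMostOne₁₀⇐ u v t)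

linear⇒ : ∀ x y → x ≼ y → IsChain (Between 0 0 x y) → T (linearᵇ x y)
linear⇒ []      []      _ _     = tt
linear⇒ (U ∷ x) (U ∷ y) p chain = linear⇒ x y p (λ r s → chain (U ∷ r) (U ∷ s))
linear⇒ (D ∷ x) (D ∷ y) p chain = linear⇒ x y p (λ r s → chain (D ∷ r) (D ∷ s))
linear⇒ (D ∷ u) (U ∷ v) p chain = fork⇒ u v p chain

linear⇐ : ∀ x y → T (linearᵇ x y) → IsChain (Between 0 0 x y)
linear⇐ []      []      _ [] [] _ _ = inj₁ tt
linear⇐ (U ∷ x) (U ∷ y) t (U ∷ r) (U ∷ s) p q = linear⇐ x y t r s p q
linear⇐ (D ∷ x) (D ∷ y) t (D ∷ r) (D ∷ s) p q = linear⇐ x y t r s p q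
linear⇐ (D ∷ u) (U ∷ v) t = fork⇐ u v t

atMostOne₀₁ᵇ⇒≼ : ∀ u v → T (atMostOne₀₁ᵇ u v) → u ≼[ 1 ] v
atMostOne₀₁ᵇ⇒≼ []      []      _ = tt
atMostOne₀₁ᵇ⇒≼ (U ∷ u) (U ∷ v) t = atMostOne₀₁ᵇ⇒≼ u v t
atMostOne₀₁ᵇ⇒≼ (U ∷ u) (D ∷ v) t with does⇒ (u ≟W v) t
... | refl = ≼-refl u

atMostOne₁₀ᵇ⇒≼ : ∀ u v → T (atMostOne₁₀ᵇ u v) → u ≼[ 1 ] v
atMostOne₁₀ᵇ⇒≼ []      []      _ = tt
atMostOne₁₀ᵇ⇒≼ (D ∷ u) (D ∷ v) t = atMostOne₁₀ᵇ⇒≼ u v t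
atMostOne₁₀ᵇ⇒≼ (U ∷ u) (D ∷ v) t with does⇒ (u ≟W v) t
... | refl = ≼-refl u

forkᵇ⇒≼ : ∀ u v → length u ≡ length v → T (forkᵇ u v) → u ≼[ 1 ] v
forkᵇ⇒≼ []       []       _ _ = tt
forkᵇ⇒≼ (U ∷ u)  (D ∷ v)  _ t with does⇒ (u ≟W v) t
... | refl = ≼-refl u
forkᵇ⇒≼ (D ∷ []) (U ∷ []) _ _ = tt
forkᵇ⇒≼ (U ∷ u)  (U ∷ v)  _ t = atMostOne₀₁ᵇ⇒≼ u v t
forkᵇ⇒≼ (D ∷ u)  (D ∷ v)  _ t = atMostOne₁₀ᵇ⇒≼ u v t

linearᵇ⇒≼ : ∀ x y → length x ≡ length y → T (linearᵇ x y) → x ≼ y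
linearᵇ⇒≼ []      []      _ _ = tt
linearᵇ⇒≼ (U ∷ x) (U ∷ y) l t = linearᵇ⇒≼ x y (ℕ.suc-injective l) t
linearᵇ⇒≼ (D ∷ x) (D ∷ y) l t = linearᵇ⇒≼ x y (ℕ.suc-injective l) t
linearᵇ⇒≼ (D ∷ u) (U ∷ v) l t = forkᵇ⇒≼ u v (ℕ.suc-injective l) t

-- Counting the linear intervals of 𝔽ₘ₊₁

extensions : Word → List Word
extensions w = (U ∷ w) ∷ (D ∷ w) ∷ []

words-length : ∀ m {w} → w ∈ words m → length w ≡ m
words-length zero (here refl) = refl
words-length (suc m) w∈ with find (∈-concatMap⁻ extensions {xs = words m} w∈)
... | v , v∈ , here refl         = cong suc (words-length m v∈)
... | v , v∈ , there (here refl) = cong suc (words-length m v∈)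

∈-words : ∀ w → w ∈ words (length w)
∈-words []      = here refl
∈-words (a ∷ w) = ∈-concatMap⁺ extensions (Any.map (λ { refl → a∷w∈ a }) (∈-words w))
  where
  a∷w∈ : ∀ a {w} → a ∷ w ∈ extensions w
  a∷w∈ U = here refl
  a∷w∈ D = there (here refl)

words-unique : ∀ m → Unique (words m)
words-unique zero    = [] ∷ []
words-unique (suc m) = subst Unique (sym (concatMap≡ (words m)))
  (Unique.cartesianProductWith⁺ (λ w c → c ∷ w) ∷-injective (words-unique m) (((λ ()) ∷ []) ∷ [] ∷ []))
  where
  concatMap≡ : ∀ ws → concatMap extensions ws ≡ cartesianProductWith (λ w c → c ∷ w) ws (U ∷ D ∷ [])
  concatMap≡ []       = refl
  concatMap≡ (w ∷ ws) = cong (λ r → (U ∷ w) ∷ (D ∷ w) ∷ r) (concatMap≡ ws)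
  ∷-injective : ∀ {w x c d} → c ∷ w ≡ d ∷ x → w ≡ x × c ≡ d
  ∷-injective refl = refl , refl

encode∈F : ∀ m {x} → x ∈ words m → encode x ∈ F (suc m)
encode∈F m {x} x∈ = ∈-filter⁺ (isF? (suc m))
  (subst (λ n → encode x ∈ words n) |encode-x| (∈-words (encode x)))
  (subst (λ n → IsF (suc n) (encode x)) (words-length m x∈) (encode-IsF x))
  where
  |encode-x| : length (encode x) ≡ 2 * suc m
  |encode-x| = trans (encode-length x) (cong (λ n → 2 * suc n) (words-length m x∈))

∈F⇒encode : ∀ m {w} → w ∈ F (suc m) → ∃[ x ] x ∈ words m × w ≡ encode x
∈F⇒encode m {w} w∈ =
  let x , l , w≡ = IsF⇒encode m w (proj₂ (∈-filter⁻ (isF? (suc m)) {xs = words (2 * suc m)} w∈))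
  in x , subst (λ n → x ∈ words n) l (∈-words x) , w≡

F↭encode-words : ∀ m → F (suc m) ↭ map encode (words m)
F↭encode-words m = ∼bag⇒↭ (unique∧set⇒bag
  (Unique.filter⁺ (isF? (suc m)) (words-unique (2 * suc m)))
  (Unique.map⁺ encode-injective (words-unique m))
  (mk⇔ to from))
  where
  to : ∀ {w} → w ∈ F (suc m) → w ∈ map encode (words m)
  to w∈ = let x , x∈ , w≡ = ∈F⇒encode m w∈
          in subst (_∈ map encode (words m)) (sym w≡) (∈-map⁺ encode x∈)
  from : ∀ {w} → w ∈ map encode (words m) → w ∈ F (suc m)
  from w∈ = let x , x∈ , w≡ = ∈-map⁻ encode w∈
            in subst (_∈ F (suc m)) (sym w≡) (encode∈F m x∈)

module _ (m : ℕ) where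

  private
    ∈-words-of : ∀ {w w′} → w ∈ words m → length w′ ≡ length w → w′ ∈ words m
    ∈-words-of {w′ = w′} w∈ l = subst (λ n → w′ ∈ words n) (trans l (words-length m w∈)) (∈-words w′)

    same-length : ∀ {w w′} → w ∈ words m → w′ ∈ words m → length w ≡ length w′
    same-length w∈ w′∈ = trans (words-length m w∈) (sym (words-length m w′∈))

  Linear⇒chain : ∀ {x y} → x ∈ words m →
                 Linear (suc m) (encode x) (encode y) → IsChain (Between 0 0 x y)
  Linear⇒chain {x} {y} x∈ lin r s (x≼r , r≼y) (x≼s , s≼y) =
    [ inj₁ ∘ encode-≤St⇒≼ r s (same-length r∈ s∈) , inj₂ ∘ encode-≤St⇒≼ s r (same-length s∈ r∈) ]′
      (All.lookup (All.lookup lin (encode∈F m r∈)) (encode∈F m s∈)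
                  (interval r∈ x≼r r≼y) (interval s∈ x≼s s≼y))
    where
    r∈ = ∈-words-of x∈ (sym (≼-length x r x≼r))
    s∈ = ∈-words-of x∈ (sym (≼-length x s x≼s))
    interval : ∀ {w} → w ∈ words m → x ≼ w → w ≼ y → InInterval (encode x) (encode y) (encode w)
    interval {w} w∈ x≼w w≼y = ≼⇒encode-≤St x w (same-length x∈ w∈) x≼w
                            , ≼⇒encode-≤St w y (≼-length w y w≼y) w≼y

  chain⇒Linear : ∀ {x y} → x ∈ words m → y ∈ words m →
                 IsChain (Between 0 0 x y) → Linear (suc m) (encode x) (encode y)
  chain⇒Linear {x} {y} x∈ y∈ chain =
    All.tabulate λ R∈ → All.tabulate λ S∈ → comparable (∈F⇒encode m R∈) (∈F⇒encode m S∈)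
    where
    between : ∀ {w} → w ∈ words m → InInterval (encode x) (encode y) (encode w) → Between 0 0 x y w
    between {w} w∈ (x≤w , w≤y) =
      encode-≤St⇒≼ x w (same-length x∈ w∈) x≤w , encode-≤St⇒≼ w y (same-length w∈ y∈) w≤y
    comparable : ∀ {R S} → ∃[ r ] r ∈ words m × R ≡ encode r → ∃[ s ] s ∈ words m × S ≡ encode s →
                 InInterval (encode x) (encode y) R → InInterval (encode x) (encode y) S → R ≤St S ⊎ S ≤St R
    comparable (r , r∈ , refl) (s , s∈ , refl) iR iS =
      [ inj₁ ∘ ≼⇒encode-≤St r s (same-length r∈ s∈) , inj₂ ∘ ≼⇒encode-≤St s r (same-length s∈ r∈) ]′
        (chain r s (between r∈ iR) (between s∈ iS))

  linear-interval⇒ : ∀ {x y} → x ∈ words m → y ∈ words m →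
                     IsLinearInterval (suc m) (encode x , encode y) → T (linearᵇ x y)
  linear-interval⇒ {x} {y} x∈ y∈ (x≤y , lin) =
    linear⇒ x y (encode-≤St⇒≼ x y (same-length x∈ y∈) x≤y) (Linear⇒chain x∈ lin)

  linear-interval⇐ : ∀ {x y} → x ∈ words m → y ∈ words m →
                     T (linearᵇ x y) → IsLinearInterval (suc m) (encode x , encode y)
  linear-interval⇐ {x} {y} x∈ y∈ t =
    ≼⇒encode-≤St x y (same-length x∈ y∈) (linearᵇ⇒≼ x y (same-length x∈ y∈) t) ,
    chain⇒Linear x∈ y∈ (linear⇐ x y t)

indicator : Bool → ℕ
indicator b = if b then 1 else 0

length-filter≡sum : ∀ {A : Set} {P : A → Set} (P? : ∀ a → Dec (P a)) xs →
                    length (filter P? xs) ≡ sum (map (indicator ∘ does ∘ P?) xs)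
length-filter≡sum P? [] = refl
length-filter≡sum P? (x ∷ xs) with does (P? x)
... | true  = cong suc (length-filter≡sum P? xs)
... | false = length-filter≡sum P? xs

sum-map-++ : ∀ {A : Set} (g : A → ℕ) xs ys → sum (map g (xs ++ ys)) ≡ sum (map g xs) + sum (map g ys)
sum-map-++ g xs ys = trans (cong sum (List.map-++ g xs ys)) (Sum.sum-++ (map g xs) (map g ys))

sum-map-cartesianProduct : ∀ {A B : Set} (g : A × B → ℕ) xs ys →
  sum (map g (cartesianProduct xs ys)) ≡ sum (map (λ x → sum (map (λ y → g (x , y)) ys)) xs)
sum-map-cartesianProduct g []       ys = refl
sum-map-cartesianProduct g (x ∷ xs) ys = begin
  sum (map g (map (x ,_) ys ++ cartesianProduct xs ys))
    ≡⟨ sum-map-++ g (map (x ,_) ys) _ ⟩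
  sum (map g (map (x ,_) ys)) + sum (map g (cartesianProduct xs ys))
    ≡⟨ cong₂ _+_ (cong sum (sym (List.map-∘ ys))) (sum-map-cartesianProduct g xs ys) ⟩
  sum (map (λ y → g (x , y)) ys) + sum (map (λ x → sum (map (λ y → g (x , y)) ys)) xs) ∎
  where open ≡-Reasoning

sum-map-↭ : ∀ {A : Set} (g : A → ℕ) {xs ys} → xs ↭ ys → sum (map g xs) ≡ sum (map g ys)
sum-map-↭ g p = Sum.sum-↭ (↭.map⁺ g p)

sum-map-+ : ∀ {A : Set} (g h : A → ℕ) xs →
            sum (map (λ x → g x + h x) xs) ≡ sum (map g xs) + sum (map h xs)
sum-map-+ g h []       = refl
sum-map-+ g h (x ∷ xs) =
  trans (cong (g x + h x ℕ.+_) (sum-map-+ g h xs))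
        (interchange (g x) (h x) (sum (map g xs)) (sum (map h xs)))

sum-map-extensions : ∀ (g : Word → ℕ) ws →
  sum (map g (concatMap extensions ws)) ≡ sum (map (g ∘ (U ∷_)) ws) + sum (map (g ∘ (D ∷_)) ws)
sum-map-extensions g []       = refl
sum-map-extensions g (w ∷ ws) = begin
  g (U ∷ w) + (g (D ∷ w) + sum (map g (concatMap extensions ws)))
    ≡⟨ cong (λ S → g (U ∷ w) + (g (D ∷ w) + S)) (sum-map-extensions g ws) ⟩
  g (U ∷ w) + (g (D ∷ w) + (sum (map (g ∘ (U ∷_)) ws) + sum (map (g ∘ (D ∷_)) ws)))
    ≡⟨ ℕ.+-assoc (g (U ∷ w)) _ _ ⟨
  g (U ∷ w) + g (D ∷ w) + (sum (map (g ∘ (U ∷_)) ws) + sum (map (g ∘ (D ∷_)) ws))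
    ≡⟨ interchange (g (U ∷ w)) (g (D ∷ w)) _ _ ⟩
  sum (map (g ∘ (U ∷_)) (w ∷ ws)) + sum (map (g ∘ (D ∷_)) (w ∷ ws)) ∎
  where open ≡-Reasoning

pairCount : (Word → Word → Bool) → ℕ → ℕ
pairCount f m = sum (map (λ x → sum (map (indicator ∘ f x) (words m))) (words m))

pairCount-suc : ∀ f m → pairCount f (suc m) ≡
  (pairCount (λ x y → f (U ∷ x) (U ∷ y)) m + pairCount (λ x y → f (U ∷ x) (D ∷ y)) m) +
  (pairCount (λ x y → f (D ∷ x) (U ∷ y)) m + pairCount (λ x y → f (D ∷ x) (D ∷ y)) m)
pairCount-suc f m = trans (sum-map-extensions row (words m)) (cong₂ _+_ (rows U) (rows D))
  where
  row : Word → ℕ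
  row x = sum (map (indicator ∘ f x) (words (suc m)))
  rows : ∀ a → sum (map (row ∘ (a ∷_)) (words m)) ≡
         pairCount (λ x y → f (a ∷ x) (U ∷ y)) m + pairCount (λ x y → f (a ∷ x) (D ∷ y)) m
  rows a = trans (cong sum (List.map-cong (λ x → sum-map-extensions (indicator ∘ f (a ∷ x)) W) W))
                 (sum-map-+ _ _ W)
    where W = words m

L≡pairCount : ∀ m → L (suc m) ≡ pairCount linearᵇ m
L≡pairCount m = begin
  L (suc m)
    ≡⟨ length-filter≡sum P? (cartesianProduct Fₙ Fₙ) ⟩
  sum (map i (cartesianProduct Fₙ Fₙ))
    ≡⟨ sum-map-cartesianProduct i Fₙ Fₙ ⟩
  sum (map (λ R → sum (map (λ S → i (R , S)) Fₙ)) Fₙ)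
    ≡⟨ sum-map-↭ _ (F↭encode-words m) ⟩
  sum (map (λ R → sum (map (λ S → i (R , S)) Fₙ)) (map encode W))
    ≡⟨ cong sum (List.map-∘ W) ⟨
  sum (map (λ x → sum (map (λ S → i (encode x , S)) Fₙ)) W)
    ≡⟨ cong sum (List.map-cong (λ x → trans (sum-map-↭ _ (F↭encode-words m)) (cong sum (sym (List.map-∘ W))))
                               W) ⟩
  sum (map (λ x → sum (map (λ y → i (encode x , encode y)) W)) W)
    ≡⟨ cong sum (List.map-cong-local (All.tabulate λ x∈ → cong sum (List.map-cong-local (All.tabulate λ y∈ →
         cong indicator (same-decision x∈ y∈))))) ⟩
  pairCount linearᵇ m ∎
  where
  open ≡-Reasoning
  W = words m
  Fₙ = F (suc m)
  P? = isLinearInterval? (suc m)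
  i = indicator ∘ does ∘ P?
  same-decision : ∀ {x y} → x ∈ W → y ∈ W → does (P? (encode x , encode y)) ≡ linearᵇ x y
  same-decision {x} {y} x∈ y∈ =
    does-⇔ (mk⇔ (linear-interval⇒ m x∈ y∈) (linear-interval⇐ m x∈ y∈))
           (P? (encode x , encode y)) (T? (linearᵇ x y))

private
  cong₄-+ : ∀ {a b c d a′ b′ c′ d′} → a ≡ a′ → b ≡ b′ → c ≡ c′ → d ≡ d′ →
            (a + b) + (c + d) ≡ (a′ + b′) + (c′ + d′)
  cong₄-+ refl refl refl refl = refl

pairCount-false : ∀ m → pairCount (λ _ _ → false) m ≡ 0
pairCount-false zero    = refl
pairCount-false (suc m) =
  trans (pairCount-suc _ m) (cong (λ z → (z + z) + (z + z)) (pairCount-false m))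

pairCount-≟ : ∀ m → pairCount (λ u v → does (u ≟W v)) m ≡ 2 ^ m
pairCount-≟ zero    = refl
pairCount-≟ (suc m) =
  trans (pairCount-suc (λ u v → does (u ≟W v)) m)
        (trans (cong₄-+ (pairCount-≟ m) (pairCount-false m) (pairCount-false m) (pairCount-≟ m))
               (arith (2 ^ m)))
  where
  arith : ∀ p → (p + 0) + (0 + p) ≡ 2 * p
  arith = ℕ-Solver.solve-∀

pairCount-atMostOne₀₁ : ∀ m → pairCount atMostOne₀₁ᵇ m ≡ 2 ^ m
pairCount-atMostOne₀₁ zero    = refl
pairCount-atMostOne₀₁ (suc m) =
  trans (pairCount-suc atMostOne₀₁ᵇ m)
        (trans (cong₄-+ (pairCount-atMostOne₀₁ m) (pairCount-≟ m) (pairCount-false m) (pairCount-false m))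
               (arith (2 ^ m)))
  where
  arith : ∀ p → (p + p) + (0 + 0) ≡ 2 * p
  arith = ℕ-Solver.solve-∀

pairCount-atMostOne₁₀ : ∀ m → pairCount atMostOne₁₀ᵇ m ≡ 2 ^ m
pairCount-atMostOne₁₀ zero    = refl
pairCount-atMostOne₁₀ (suc m) =
  trans (pairCount-suc atMostOne₁₀ᵇ m)
        (trans (cong₄-+ (pairCount-false m) (pairCount-≟ m) (pairCount-false m) (pairCount-atMostOne₁₀ m))
               (arith (2 ^ m)))
  where
  arith : ∀ p → (0 + p) + (0 + p) ≡ 2 * p
  arith = ℕ-Solver.solve-∀

pairCount-fork : ∀ m → pairCount forkᵇ (2 + m) ≡ 3 * 2 ^ suc m
pairCount-fork m =
  trans (pairCount-suc forkᵇ (suc m))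
        (trans (cong₄-+ (pairCount-atMostOne₀₁ (suc m)) (pairCount-≟ (suc m))
                        null-count (pairCount-atMostOne₁₀ (suc m)))
               (arith (2 ^ suc m)))
  where
  null-count : pairCount (λ u _ → null u) (suc m) ≡ 0
  null-count = trans (pairCount-suc _ m) (cong (λ z → (z + z) + (z + z)) (pairCount-false m))
  arith : ∀ p → (p + p) + (0 + p) ≡ 3 * p
  arith = ℕ-Solver.solve-∀

pairCount-linear-suc : ∀ m → pairCount linearᵇ (suc m) ≡ 2 * pairCount linearᵇ m + pairCount forkᵇ m
pairCount-linear-suc m =
  trans (pairCount-suc linearᵇ m) (trans (cong (λ z → (t + z) + (g + t)) (pairCount-false m)) (arith t g))
  where
  t = pairCount linearᵇ m
  g = pairCount forkᵇ m
  arith : ∀ t g → (t + 0) + (g + t) ≡ 2 * t + g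
  arith = ℕ-Solver.solve-∀

pairCount-linear-formula : ∀ j → pairCount linearᵇ (2 + j) ≡ (3 * j + 10) * 2 ^ j
pairCount-linear-formula zero    = refl
pairCount-linear-formula (suc j) = begin
  pairCount linearᵇ (3 + j)                                   ≡⟨ pairCount-linear-suc (2 + j) ⟩
  2 * pairCount linearᵇ (2 + j) + pairCount forkᵇ (2 + j)
    ≡⟨ cong₂ (λ t g → 2 * t + g) (pairCount-linear-formula j) (pairCount-fork j) ⟩
  2 * ((3 * j + 10) * 2 ^ j) + 3 * 2 ^ suc j                  ≡⟨ arith j (2 ^ j) ⟩
  (3 * suc j + 10) * 2 ^ suc j                                ∎
  where
  open ≡-Reasoning
  arith : ∀ j p → 2 * ((3 * j + 10) * p) + 3 * (2 * p) ≡ (3 * suc j + 10) * (2 * p)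
  arith = ℕ-Solver.solve-∀

-- The generating function

sumTo-cong : ∀ n {f g : ℕ → ℤ} → (∀ k → f k ≡ g k) → sumTo n f ≡ sumTo n g
sumTo-cong zero    f≗g = f≗g 0
sumTo-cong (suc n) f≗g = cong₂ ℤ._+_ (sumTo-cong n f≗g) (f≗g (suc n))

sumTo-zero : ∀ n (f : ℕ → ℤ) → (∀ k → k ≤ n → f k ≡ + 0) → sumTo n f ≡ + 0
sumTo-zero zero    f f≡0 = f≡0 0 z≤n
sumTo-zero (suc n) f f≡0 =
  cong₂ ℤ._+_ (sumTo-zero n f (λ k k≤n → f≡0 k (ℕ.m≤n⇒m≤1+n k≤n))) (f≡0 (suc n) ℕ.≤-refl)

⊛-congˡ : ∀ {f g : Series} h n → (∀ k → f k ≡ g k) → (f ⊛ h) n ≡ (g ⊛ h) n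
⊛-congˡ h n f≗g = sumTo-cong n (λ k → cong (ℤ._* h (n ∸ k)) (f≗g k))

⊛-quadratic : ∀ f a b c n →
  (f ⊛ poly (a ∷ b ∷ c ∷ [])) (3 + n) ≡ f (1 + n) ℤ.* c ℤ.+ f (2 + n) ℤ.* b ℤ.+ f (3 + n) ℤ.* a
⊛-quadratic f a b c n = begin
  sumTo n h ℤ.+ h (1 + n) ℤ.+ h (2 + n) ℤ.+ h (3 + n)
    ≡⟨ cong (λ s → s ℤ.+ h (1 + n) ℤ.+ h (2 + n) ℤ.+ h (3 + n)) (sumTo-zero n h vanish) ⟩
  + 0 ℤ.+ h (1 + n) ℤ.+ h (2 + n) ℤ.+ h (3 + n)
    ≡⟨ cong (λ s → s ℤ.+ h (2 + n) ℤ.+ h (3 + n)) (ℤ.+-identityˡ (h (1 + n))) ⟩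
  h (1 + n) ℤ.+ h (2 + n) ℤ.+ h (3 + n)
    ≡⟨ cong₂ ℤ._+_ (cong₂ ℤ._+_ (coefficient (1 + n) (ℕ.m+n∸n≡m 2 n)) (coefficient (2 + n) (ℕ.m+n∸n≡m 1 n)))
                   (coefficient (3 + n) (ℕ.n∸n≡0 n)) ⟩
  f (1 + n) ℤ.* c ℤ.+ f (2 + n) ℤ.* b ℤ.+ f (3 + n) ℤ.* a ∎
  where
  open ≡-Reasoning
  q = poly (a ∷ b ∷ c ∷ [])
  h : ℕ → ℤ
  h k = f k ℤ.* q (3 + n ∸ k)
  vanish : ∀ k → k ≤ n → h k ≡ + 0
  vanish k k≤n = trans (cong (λ i → f k ℤ.* q i) (ℕ.+-∸-assoc 3 k≤n)) (ℤ.*-zeroʳ (f k))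
  coefficient : ∀ k {i} → 3 + n ∸ k ≡ i → h k ≡ f k ℤ.* q i
  coefficient k eq = cong (λ i → f k ℤ.* q i) eq

closedL : ℕ → ℕ
closedL 0 = 1
closedL 1 = 1
closedL 2 = 3
closedL (suc (suc (suc j))) = (3 * j + 10) * 2 ^ j

L≡closedL : ∀ n → L n ≡ closedL n
L≡closedL 0 = refl
L≡closedL 1 = refl
L≡closedL 2 = refl
L≡closedL (suc (suc (suc j))) = trans (L≡pairCount (2 + j)) (pairCount-linear-formula j)

closedL-recurrence : ∀ j → closedL (3 + j) * 4 + closedL (5 + j) ≡ closedL (4 + j) * 4
closedL-recurrence j = arith j (2 ^ j)
  where
  arith : ∀ j p → (3 * j + 10) * p * 4 + (3 * (2 + j) + 10) * (2 * (2 * p)) ≡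
                  (3 * (1 + j) + 10) * (2 * p) * 4
  arith = ℕ-Solver.solve-∀

closedL⊛denominator : ∀ j → ((+_ ∘ closedL) ⊛ denominator) (5 + j) ≡ + 0
closedL⊛denominator j = begin
  ((+_ ∘ closedL) ⊛ denominator) (5 + j)
    ≡⟨ ⊛-quadratic (+_ ∘ closedL) _ _ _ (2 + j) ⟩
  + a ℤ.* + 4 ℤ.+ + b ℤ.* ℤ.- + 4 ℤ.+ + c ℤ.* + 1
    ≡⟨ rearrange (+ a) (+ b) (+ c) ⟩
  (+ a ℤ.* + 4 ℤ.+ + c) ℤ.- + b ℤ.* + 4
    ≡⟨ cong₂ ℤ._-_ (trans (ℤ.pos-+ (a * 4) c) (cong (ℤ._+ + c) (ℤ.pos-* a 4))) (ℤ.pos-* b 4) ⟨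
  + (a * 4 + c) ℤ.- + (b * 4)
    ≡⟨ cong (λ w → + w ℤ.- + (b * 4)) (closedL-recurrence j) ⟩
  + (b * 4) ℤ.- + (b * 4)
    ≡⟨ ℤ.+-inverseʳ (+ (b * 4)) ⟩
  + 0 ∎
  where
  open ≡-Reasoning
  a = closedL (3 + j)
  b = closedL (4 + j)
  c = closedL (5 + j)
  rearrange : ∀ x y z → x ℤ.* + 4 ℤ.+ y ℤ.* ℤ.- + 4 ℤ.+ z ℤ.* + 1 ≡ (x ℤ.* + 4 ℤ.+ z) ℤ.- y ℤ.* + 4
  rearrange = solve-∀

generating-function : ∀ n → (genL ⊛ denominator) n ≡ numerator n
generating-function n = trans (⊛-congˡ denominator n (λ k → cong +_ (L≡closedL k))) (closed n)
  where
  closed : ∀ n → ((+_ ∘ closedL) ⊛ denominator) n ≡ numerator n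
  closed 0 = refl
  closed 1 = refl
  closed 2 = refl
  closed 3 = refl
  closed 4 = refl
  closed (suc (suc (suc (suc (suc j))))) = closedL⊛denominator j

L-formula : ∀ n → 3 ≤ n → L n ≡ (3 * n + 1) * 2 ^ (n ∸ 3)
L-formula (suc (suc (suc j))) (s≤s (s≤s (s≤s _))) =
  trans (L≡closedL (3 + j)) (cong (_* 2 ^ j) (arith j))
  where
  arith : ∀ j → 3 * j + 10 ≡ 3 * (3 + j) + 1
  arith = ℕ-Solver.solve-∀

corollary3p10 : ((n : ℕ) → (genL ⊛ denominator) n ≡ numerator n)
                × (L 0 ≡ 1) × (L 1 ≡ 1) × (L 2 ≡ 3)
                × ((n : ℕ) → 3 ≤ n → L n ≡ (3 * n + 1) * 2 ^ (n ∸ 3))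
corollary3p10 = generating-function , refl , refl , refl , L-formula
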